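{- Let $p>2$ be a prime and $r>1$ an integer with $r\equiv1\pmod{p-1}$, and put $t=v(r-1)$. Then for all $\lambda\in\mathbb{F}_p$, $$\sum_{\mu\in\mathbb{F}_p}([\mu]x-[\lambda]x+py)^r\equiv -[\lambda]rpx^r+rp(p-1)x^{r-1}y\pmod{p^{t+2}\overline{\mathbb{Z}}_p[x,y]}.$$
   Context: $v$ is the $p$-adic valuation with $v(p)=1$; $\overline{\mathbb{Z}}_p$ is the ring of integers of an algebraic closure of $\mathbb{Q}_p$; for $\lambda\in\mathbb{F}_p$, $[\lambda]\in\mathbb{Z}_p$ is its Teichmüller lift; $x,y$ are indeterminates. -}

module Defs where

open import Data.Nat as ℕ using (ℕ; zero; suc; _∸_)
open import Data.Fin using (Fin; toℕ)
open import Data.Integer as ℤ using (ℤ; +_; _+_; _-_; _*_; -_; _^_)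
open import Data.Integer.Divisibility using (_∣_)

-- Bivariate polynomials with integer coefficients, given by their
-- coefficient function: (f i j) is the coefficient of x^i y^j.
Poly2 : Set
Poly2 = ℕ → ℕ → ℤ

sumTo : ℕ → (ℕ → ℤ) → ℤ
sumTo zero    g = + 0
sumTo (suc n) g = sumTo n g + g n

sumFin : ∀ {n} → (Fin n → Poly2) → Poly2
sumFin {zero}  F i j = + 0
sumFin {suc n} F i j = F Data.Fin.zero i j + sumFin {n} (λ k → F (Data.Fin.suc k)) i j

cst : ℤ → Poly2
cst c zero zero = c
cst c _    _    = + 0

X : Poly2
X (suc zero) zero = + 1
X _ _ = + 0

Y : Poly2
Y zero (suc zero) = + 1
Y _ _ = + 0

_⊕_ : Poly2 → Poly2 → Poly2
(f ⊕ g) i j = f i j + g i j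

_⊖_ : Poly2 → Poly2 → Poly2
(f ⊖ g) i j = f i j - g i j

_·_ : ℤ → Poly2 → Poly2
(c · f) i j = c * f i j

_⊗_ : Poly2 → Poly2 → Poly2
(f ⊗ g) i j = sumTo (suc i) (λ a → sumTo (suc j) (λ b → f a b * g (i ∸ a) (j ∸ b)))

_^ᴾ_ : Poly2 → ℕ → Poly2
f ^ᴾ zero  = cst (+ 1)
f ^ᴾ suc n = f ⊗ (f ^ᴾ n)

_≡_[modᴾ_] : Poly2 → Poly2 → ℕ → Set
f ≡ g [modᴾ m ] = ∀ i j → (+ m) ∣ (f i j - g i j)

-- T is the family of Teichmüller lifts of F_p = Fin p, reduced modulo p^N:
-- T μ ≡ μ (mod p) and T μ is a root of X^p - X modulo p^N.
IsTeichmüllerMod : (p N : ℕ) → (Fin p → ℤ) → Set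
IsTeichmüllerMod p N T =
  ∀ μ → ((+ p) ∣ (T μ - + toℕ μ)) Data.Product.× ((+ (p ℕ.^ N)) ∣ (T μ ^ p - T μ))
  where import Data.Product

{-# OPTIONS --safe #-}
module Submission where

-- Put d_μ = [μ] − [λ]; the coefficient of x^i y^j in (d_μ x + p y)^r is C(r,j) d_μ^i p^j. For j ≥ 2
-- it vanishes modulo p^(t+2): p^t ∣ r − 1 and p ≥ 3 give p^(t+2) ∣ p^j C(r,j). Write r − 1 = (p−1) p^t w.
-- For a unit d, d^(p−1) = 1 + qp lifts to d^((p−1)p^t) ≡ 1 + q p^(t+1) (mod p^(t+2)), whence
-- d^(r−1) ≡ 1 (mod p^(t+1)) and d^r ≡ (1 − w p^t) d + w p^t d^p (mod p^(t+2)); for μ = λ both sides are 0.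
-- Summed over μ this leaves Σ [μ] ≡ 0 (mod p^(t+2)) and Σ ([μ] − [λ])^p ≡ 0 (mod p²), and both reduce
-- to the power sums Σ_{j<p} (j − c)^(p^k) ≡ 0 (mod p^(k+1)): these do not depend on c, because
-- (x + p)^(p^k) ≡ x^(p^k), and vanish at c = (p−1)/2, because the exponent p^k is odd.

module Congruence where

  open import Data.Nat.Base using (zero; suc)
  open import Data.Integer.Base using (ℤ; +_; _+_; _-_; _*_; -_; _^_)
  open import Data.Integer.Divisibility.Signed
  open import Data.Integer.Tactic.RingSolver using (solve-∀)
  open import Relation.Binary.Bundles using (Setoid)
  open import Relation.Binary.Structures using (IsEquivalence)
  open import Relation.Binary.PropositionalEquality using (_≡_; refl; subst)

  infix 4 _≡_[mod_]

  record _≡_[mod_] (a b m : ℤ) : Set where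
    constructor mod-∣
    field ∣-difference : m ∣ a - b

  open _≡_[mod_] public

  module _ {m : ℤ} where

    ≡⇒≡-mod : ∀ {a b} → a ≡ b → a ≡ b [mod m ]
    ≡⇒≡-mod {a} refl = mod-∣ (divides (+ 0) (a-a≡0*m a m))
      where
      a-a≡0*m : ∀ a m → a - a ≡ + 0 * m
      a-a≡0*m = solve-∀

    ≡-mod-refl : ∀ {a} → a ≡ a [mod m ]
    ≡-mod-refl = ≡⇒≡-mod refl

    ≡-mod-sym : ∀ {a b} → a ≡ b [mod m ] → b ≡ a [mod m ]
    ≡-mod-sym {a} {b} (mod-∣ d) = mod-∣ (subst (m ∣_) (-[a-b]≡b-a a b) (∣m⇒∣-m d))
      where
      -[a-b]≡b-a : ∀ a b → - (a - b) ≡ b - a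
      -[a-b]≡b-a = solve-∀

    ≡-mod-trans : ∀ {a b c} → a ≡ b [mod m ] → b ≡ c [mod m ] → a ≡ c [mod m ]
    ≡-mod-trans {a} {b} {c} (mod-∣ d₁) (mod-∣ d₂) =
      mod-∣ (subst (m ∣_) (telescope a b c) (∣m∣n⇒∣m+n d₁ d₂))
      where
      telescope : ∀ a b c → (a - b) + (b - c) ≡ a - c
      telescope = solve-∀

    ≡-mod-isEquivalence : IsEquivalence (λ a b → a ≡ b [mod m ])
    ≡-mod-isEquivalence = record { refl = ≡-mod-refl ; sym = ≡-mod-sym ; trans = ≡-mod-trans }

    +-cong-mod : ∀ {a b c d} → a ≡ b [mod m ] → c ≡ d [mod m ] → a + c ≡ b + d [mod m ]
    +-cong-mod {a} {b} {c} {d} (mod-∣ d₁) (mod-∣ d₂) =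
      mod-∣ (subst (m ∣_) (interchange a b c d) (∣m∣n⇒∣m+n d₁ d₂))
      where
      interchange : ∀ a b c d → (a - b) + (c - d) ≡ (a + c) - (b + d)
      interchange = solve-∀

    neg-cong-mod : ∀ {a b} → a ≡ b [mod m ] → - a ≡ - b [mod m ]
    neg-cong-mod {a} {b} (mod-∣ d) = mod-∣ (subst (m ∣_) (neg-distrib a b) (∣m⇒∣-m d))
      where
      neg-distrib : ∀ a b → - (a - b) ≡ - a - - b
      neg-distrib = solve-∀

    -‿cong-mod : ∀ {a b c d} → a ≡ b [mod m ] → c ≡ d [mod m ] → a - c ≡ b - d [mod m ]
    -‿cong-mod a≡b c≡d = +-cong-mod a≡b (neg-cong-mod c≡d)

    *-cong-mod : ∀ {a b c d} → a ≡ b [mod m ] → c ≡ d [mod m ] → a * c ≡ b * d [mod m ]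
    *-cong-mod {a} {b} {c} {d} (mod-∣ d₁) (mod-∣ d₂) =
      mod-∣ (subst (m ∣_) (split a b c d) (∣m∣n⇒∣m+n (∣m⇒∣m*n c d₁) (∣n⇒∣m*n b d₂)))
      where
      split : ∀ a b c d → (a - b) * c + b * (c - d) ≡ a * c - b * d
      split = solve-∀

    *-congˡ-mod : ∀ c {a b} → a ≡ b [mod m ] → c * a ≡ c * b [mod m ]
    *-congˡ-mod c = *-cong-mod (≡-mod-refl {c})

    ^-cong-mod : ∀ {a b} n → a ≡ b [mod m ] → a ^ n ≡ b ^ n [mod m ]
    ^-cong-mod zero    a≡b = ≡-mod-refl
    ^-cong-mod (suc n) a≡b = *-cong-mod a≡b (^-cong-mod n a≡b)

    ∣⇒≡-mod-0 : ∀ {a} → m ∣ a → a ≡ + 0 [mod m ]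
    ∣⇒≡-mod-0 {a} m∣a = mod-∣ (subst (m ∣_) (a≡a-0 a) m∣a)
      where
      a≡a-0 : ∀ a → a ≡ a - + 0
      a≡a-0 = solve-∀

    ≡-mod-0⇒∣ : ∀ {a} → a ≡ + 0 [mod m ] → m ∣ a
    ≡-mod-0⇒∣ {a} (mod-∣ m∣a-0) = subst (m ∣_) (a-0≡a a) m∣a-0
      where
      a-0≡a : ∀ a → a - + 0 ≡ a
      a-0≡a = solve-∀

  mod-setoid : ℤ → Setoid _ _
  mod-setoid m = record { isEquivalence = ≡-mod-isEquivalence {m} }

  module ≡-mod-Reasoning (m : ℤ) where
    open import Relation.Binary.Reasoning.Setoid (mod-setoid m) public

  ≡-mod-∣-weaken : ∀ {a b m n} → m ∣ n → a ≡ b [mod n ] → a ≡ b [mod m ]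
  ≡-mod-∣-weaken m∣n (mod-∣ n∣a-b) = mod-∣ (∣-trans m∣n n∣a-b)

  ≡-mod-scale : ∀ {a b m} c → a ≡ b [mod m ] → c * a ≡ c * b [mod c * m ]
  ≡-mod-scale {a} {b} c (mod-∣ d) = mod-∣ (subst (c * _ ∣_) (factor c a b) (*-monoʳ-∣ c d))
    where
    factor : ∀ c a b → c * (a - b) ≡ c * a - c * b
    factor = solve-∀

module FiniteSums where

  open import Data.Nat.Base as ℕ using (ℕ; zero; suc; _∸_; _<_)
  import Data.Nat.Properties as ℕ
  open import Data.Fin.Base using (Fin; toℕ)
  import Data.Fin.Base as Fin
  open import Data.Integer.Base using (ℤ; +_; _+_; _*_; -_)
  import Data.Integer.Properties as ℤ
  open import Function.Base using (_∘_)
  open import Relation.Binary.PropositionalEquality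
  open import Defs using (Poly2; sumTo; sumFin)
  open Congruence

  open import Algebra.Properties.Semiring.Sum ℤ.+-*-semiring public
    using (sum; sum-cong-≗; sum-replicate-zero; ∑-distrib-+; *-distribˡ-sum; sum-remove)

  sumTo-cong : ∀ n {f g : ℕ → ℤ} → (∀ k → k < n → f k ≡ g k) → sumTo n f ≡ sumTo n g
  sumTo-cong zero    f≡g = refl
  sumTo-cong (suc n) f≡g =
    cong₂ _+_ (sumTo-cong n (λ k k<n → f≡g k (ℕ.m<n⇒m<1+n k<n))) (f≡g n ℕ.≤-refl)

  sumTo-zero : ∀ n {f : ℕ → ℤ} → (∀ k → k < n → f k ≡ + 0) → sumTo n f ≡ + 0
  sumTo-zero zero    f≡0 = refl
  sumTo-zero (suc n) f≡0 =
    cong₂ _+_ (sumTo-zero n (λ k k<n → f≡0 k (ℕ.m<n⇒m<1+n k<n))) (f≡0 n ℕ.≤-refl)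

  sumTo-suc-head : ∀ n (f : ℕ → ℤ) → sumTo (suc n) f ≡ f 0 + sumTo n (f ∘ suc)
  sumTo-suc-head zero    f = ℤ.+-comm (+ 0) (f 0)
  sumTo-suc-head (suc n) f = begin
    sumTo (suc n) f + f (suc n)               ≡⟨ cong (_+ f (suc n)) (sumTo-suc-head n f) ⟩
    f 0 + sumTo n (f ∘ suc) + f (suc n)       ≡⟨ ℤ.+-assoc (f 0) _ _ ⟩
    f 0 + sumTo (suc n) (f ∘ suc)             ∎
    where open ≡-Reasoning

  sumTo-reverse : ∀ n (f : ℕ → ℤ) → sumTo n f ≡ sumTo n (λ k → f (n ∸ suc k))
  sumTo-reverse zero    f = refl
  sumTo-reverse (suc n) f = begin
    sumTo n f + f n                           ≡⟨ ℤ.+-comm (sumTo n f) (f n) ⟩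
    f n + sumTo n f                           ≡⟨ cong (λ s → f n + s) (sumTo-reverse n f) ⟩
    f n + sumTo n (λ k → f (n ∸ suc k))       ≡⟨ sumTo-suc-head n (λ k → f (n ∸ k)) ⟨
    sumTo (suc n) (λ k → f (n ∸ k))           ∎
    where open ≡-Reasoning

  sumTo-neg : ∀ n (f : ℕ → ℤ) → sumTo n (λ k → - f k) ≡ - sumTo n f
  sumTo-neg zero    f = refl
  sumTo-neg (suc n) f =
    trans (cong (_+ - f n) (sumTo-neg n f)) (sym (ℤ.neg-distrib-+ (sumTo n f) (f n)))

  sumFin-coefficient : ∀ {n} (G : Fin n → Poly2) i j → sumFin G i j ≡ sum (λ μ → G μ i j)
  sumFin-coefficient {zero}  G i j = refl
  sumFin-coefficient {suc n} G i j = cong (λ s → G Fin.zero i j + s) (sumFin-coefficient (G ∘ Fin.suc) i j)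

  sum-toℕ : ∀ {n} (f : ℕ → ℤ) → sum {n} (f ∘ toℕ) ≡ sumTo n f
  sum-toℕ {zero}  f = refl
  sum-toℕ {suc n} f = trans (cong (λ s → f 0 + s) (sum-toℕ {n} (f ∘ suc))) (sym (sumTo-suc-head n f))

  sum-const : ∀ n c → sum {n} (λ _ → c) ≡ + n * c
  sum-const zero    c = sym (ℤ.*-zeroˡ c)
  sum-const (suc n) c = begin
    c + sum {n} (λ _ → c)   ≡⟨ cong (λ s → c + s) (sum-const n c) ⟩
    c + + n * c             ≡⟨ ℤ.suc-* (+ n) c ⟨
    + suc n * c             ∎
    where open ≡-Reasoning

  sum-cong-mod : ∀ {n m} {f g : Fin n → ℤ} → (∀ μ → f μ ≡ g μ [mod m ]) → sum f ≡ sum g [mod m ]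
  sum-cong-mod {zero}  f≡g = ≡-mod-refl
  sum-cong-mod {suc n} f≡g = +-cong-mod (f≡g Fin.zero) (sum-cong-mod (f≡g ∘ Fin.suc))

module BivariatePolynomials where

  open import Data.Nat.Base as ℕ using (ℕ; zero; suc; _∸_)
  import Data.Nat.Properties as ℕ
  open import Data.Nat.Combinatorics using (_C_; nCn≡1; nCk+nC[k+1]≡[n+1]C[k+1])
  open import Data.Integer.Base using (ℤ; +_; _+_; _*_; _^_)
  import Data.Integer.Properties as ℤ
  open import Data.Integer.Tactic.RingSolver using (solve-∀)
  open import Data.Empty using (⊥-elim)
  open import Function.Base using (_∘_)
  open import Relation.Nullary.Negation using (¬_)
  open import Data.Product.Base using (_×_; _,_)
  open import Relation.Binary.PropositionalEquality
  open import Defs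
  open FiniteSums

  infix 4 _≐_

  _≐_ : Poly2 → Poly2 → Set
  f ≐ g = ∀ i j → f i j ≡ g i j

  ⊗-cong : ∀ {f f′ g g′} → f ≐ f′ → g ≐ g′ → f ⊗ g ≐ f′ ⊗ g′
  ⊗-cong f≐f′ g≐g′ i j = sumTo-cong (suc i) λ a _ → sumTo-cong (suc j) λ b _ →
    cong₂ _*_ (f≐f′ a b) (g≐g′ (i ∸ a) (j ∸ b))

  ^ᴾ-cong : ∀ {f g} n → f ≐ g → f ^ᴾ n ≐ g ^ᴾ n
  ^ᴾ-cong zero    f≐g i j = refl
  ^ᴾ-cong (suc n) f≐g     = ⊗-cong f≐g (^ᴾ-cong n f≐g)

  ⊗-comm : ∀ f g → f ⊗ g ≐ g ⊗ f
  ⊗-comm f g i j = begin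
    sumTo (suc i) (λ a → sumTo (suc j) (λ b → f a b * g (i ∸ a) (j ∸ b)))
      ≡⟨ sumTo-reverse (suc i) _ ⟩
    sumTo (suc i) (λ a → sumTo (suc j) (λ b → f (i ∸ a) b * g (i ∸ (i ∸ a)) (j ∸ b)))
      ≡⟨ sumTo-cong (suc i) (λ a a≤i → sumTo-cong (suc j) λ b _ →
           cong (λ c → f (i ∸ a) b * g c (j ∸ b)) (ℕ.m∸[m∸n]≡n (ℕ.≤-pred a≤i))) ⟩
    sumTo (suc i) (λ a → sumTo (suc j) (λ b → f (i ∸ a) b * g a (j ∸ b)))
      ≡⟨ sumTo-cong (suc i) (λ a _ → sumTo-reverse (suc j) _) ⟩
    sumTo (suc i) (λ a → sumTo (suc j) (λ b → f (i ∸ a) (j ∸ b) * g a (j ∸ (j ∸ b))))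
      ≡⟨ sumTo-cong (suc i) (λ a _ → sumTo-cong (suc j) λ b b≤j →
           trans (cong (λ c → f (i ∸ a) (j ∸ b) * g a c) (ℕ.m∸[m∸n]≡n (ℕ.≤-pred b≤j)))
                 (ℤ.*-comm (f (i ∸ a) (j ∸ b)) (g a b))) ⟩
    sumTo (suc i) (λ a → sumTo (suc j) (λ b → g a b * f (i ∸ a) (j ∸ b)))
      ∎
    where open ≡-Reasoning

  linear : ℤ → ℤ → Poly2
  linear a b (suc zero) zero       = a
  linear a b zero       (suc zero) = b
  linear a b _          _          = + 0

  shiftX : Poly2 → Poly2
  shiftX g zero    j = + 0
  shiftX g (suc i) j = g i j

  shiftY : Poly2 → Poly2
  shiftY g i zero    = + 0
  shiftY g i (suc j) = g i j

  sumTo-zero-multiples : ∀ n (h : ℕ → ℤ) → sumTo n (λ l → + 0 * h l) ≡ + 0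
  sumTo-zero-multiples n h = sumTo-zero n (λ l _ → ℤ.*-zeroˡ (h l))

  linear-⊗-first-row : ∀ a b g i j → sumTo (suc j) (λ l → linear a b 0 l * g i (j ∸ l)) ≡ b * shiftY g i j
  linear-⊗-first-row a b g i zero    = trans (ℤ.*-zeroˡ (g i 0)) (sym (ℤ.*-zeroʳ b))
  linear-⊗-first-row a b g i (suc j) = begin
    sumTo (suc (suc j)) (λ l → linear a b 0 l * g i (suc j ∸ l))
      ≡⟨ sumTo-suc-head (suc j) (λ l → linear a b 0 l * g i (suc j ∸ l)) ⟩
    + 0 * g i (suc j) + rest
      ≡⟨ cong (_+ rest) (ℤ.*-zeroˡ (g i (suc j))) ⟩
    + 0 + rest
      ≡⟨ ℤ.+-identityˡ rest ⟩
    rest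
      ≡⟨ sumTo-suc-head j (λ l → linear a b 0 (suc l) * g i (j ∸ l)) ⟩
    b * g i j + sumTo j (λ l → + 0 * g i (j ∸ suc l))
      ≡⟨ cong (λ s → b * g i j + s) (sumTo-zero-multiples j (λ l → g i (j ∸ suc l))) ⟩
    b * g i j + + 0
      ≡⟨ ℤ.+-identityʳ (b * g i j) ⟩
    b * g i j
      ∎
    where
    open ≡-Reasoning
    rest = sumTo (suc j) (λ l → linear a b 0 (suc l) * g i (j ∸ l))

  linear-⊗-later-rows : ∀ a b g i j →
    sumTo i (λ k → sumTo (suc j) (λ l → linear a b (suc k) l * g (i ∸ suc k) (j ∸ l))) ≡ a * shiftX g i j
  linear-⊗-later-rows a b g zero    j = sym (ℤ.*-zeroʳ a)
  linear-⊗-later-rows a b g (suc i) j = begin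
    sumTo (suc i) (λ k → sumTo (suc j) (λ l → linear a b (suc k) l * g (suc i ∸ suc k) (j ∸ l)))
      ≡⟨ sumTo-suc-head i (λ k → sumTo (suc j) (λ l → linear a b (suc k) l * g (i ∸ k) (j ∸ l))) ⟩
    sumTo (suc j) (λ l → linear a b 1 l * g i (j ∸ l))
      + sumTo i (λ k → sumTo (suc j) (λ l → + 0 * g (i ∸ suc k) (j ∸ l)))
      ≡⟨ cong₂ _+_ (sumTo-suc-head j (λ l → linear a b 1 l * g i (j ∸ l)))
                   (sumTo-zero i (λ k _ → sumTo-zero-multiples (suc j) (λ l → g (i ∸ suc k) (j ∸ l)))) ⟩
    (a * g i j + sumTo j (λ l → + 0 * g i (j ∸ suc l))) + + 0
      ≡⟨ cong (λ s → (a * g i j + s) + + 0) (sumTo-zero-multiples j (λ l → g i (j ∸ suc l))) ⟩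
    (a * g i j + + 0) + + 0
      ≡⟨ trans (ℤ.+-identityʳ (a * g i j + + 0)) (ℤ.+-identityʳ (a * g i j)) ⟩
    a * g i j
      ∎
    where open ≡-Reasoning

  linear-⊗ : ∀ a b g → linear a b ⊗ g ≐ (a · shiftX g) ⊕ (b · shiftY g)
  linear-⊗ a b g i j = begin
    sumTo (suc i) row                         ≡⟨ sumTo-suc-head i row ⟩
    row 0 + sumTo i (row ∘ suc)               ≡⟨ cong₂ _+_ (linear-⊗-first-row a b g i j) (linear-⊗-later-rows a b g i j) ⟩
    b * shiftY g i j + a * shiftX g i j       ≡⟨ ℤ.+-comm (b * shiftY g i j) (a * shiftX g i j) ⟩
    a * shiftX g i j + b * shiftY g i j       ∎
    where
    open ≡-Reasoning
    row : ℕ → ℤ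
    row k = sumTo (suc j) (λ l → linear a b k l * g (i ∸ k) (j ∸ l))

  binomial-pascal : ∀ a b n i j → a * (+ (n C suc j) * (a ^ i * b ^ suc j)) + b * (+ (n C j) * (a ^ suc i * b ^ j))
                                  ≡ + (suc n C suc j) * (a ^ suc i * b ^ suc j)
  binomial-pascal a b n i j = begin
    a * (+ (n C suc j) * (a ^ i * b ^ suc j)) + b * (+ (n C j) * (a ^ suc i * b ^ j))
      ≡⟨ collect a b (a ^ i) (b ^ j) (+ (n C j)) (+ (n C suc j)) ⟩
    (+ (n C j) + + (n C suc j)) * (a ^ suc i * b ^ suc j)
      ≡⟨ cong (_* (a ^ suc i * b ^ suc j)) (sym (ℤ.pos-+ (n C j) (n C suc j))) ⟩
    + (n C j ℕ.+ n C suc j) * (a ^ suc i * b ^ suc j)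
      ≡⟨ cong (λ c → + c * (a ^ suc i * b ^ suc j)) (nCk+nC[k+1]≡[n+1]C[k+1] n j) ⟩
    + (suc n C suc j) * (a ^ suc i * b ^ suc j)
      ∎
    where
    open ≡-Reasoning
    collect : ∀ a b A B c₁ c₂ → a * (c₂ * (A * (b * B))) + b * (c₁ * ((a * A) * B)) ≡ (c₁ + c₂) * ((a * A) * (b * B))
    collect = solve-∀

  linear-^ᴾ-binomial : ∀ a b n i j → i ℕ.+ j ≡ n → (linear a b ^ᴾ n) i j ≡ + (n C j) * (a ^ i * b ^ j)
  linear-^ᴾ-binomial a b zero    zero    zero    _ = refl
  linear-^ᴾ-binomial a b (suc n) i       j       e =
    trans (linear-⊗ a b (linear a b ^ᴾ n) i j) (step i j e)
    where
    P = linear a b ^ᴾ n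
    IH = linear-^ᴾ-binomial a b n
    x-power : ∀ a A b → a * (+ 1 * (A * + 1)) + b * + 0 ≡ + 1 * (a * A * + 1)
    x-power = solve-∀
    y-power : ∀ a b B → a * + 0 + b * (+ 1 * (+ 1 * B)) ≡ + 1 * (+ 1 * (b * B))
    y-power = solve-∀
    step : ∀ i j → i ℕ.+ j ≡ suc n → a * shiftX P i j + b * shiftY P i j ≡ + (suc n C j) * (a ^ i * b ^ j)
    step (suc i) zero    e = trans (cong (λ c → a * c + b * + 0) (IH i 0 (ℕ.suc-injective e))) (x-power a (a ^ i) b)
    step zero    (suc j) refl = begin
      a * + 0 + b * P 0 j                          ≡⟨ cong (λ c → a * + 0 + b * c) (IH 0 j refl) ⟩
      a * + 0 + b * (+ (j C j) * (+ 1 * b ^ j))    ≡⟨ cong (λ c → a * + 0 + b * (+ c * (+ 1 * b ^ j))) (nCn≡1 j) ⟩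
      a * + 0 + b * (+ 1 * (+ 1 * b ^ j))          ≡⟨ y-power a b (b ^ j) ⟩
      + 1 * (+ 1 * (b * b ^ j))                    ≡⟨ cong (λ c → + c * (+ 1 * (b * b ^ j))) (nCn≡1 (suc j)) ⟨
      + (suc j C suc j) * (+ 1 * (b * b ^ j))      ∎
      where open ≡-Reasoning
    step (suc i) (suc j) e = trans (cong₂ (λ u v → a * u + b * v)
                                     (IH i (suc j) (ℕ.suc-injective e))
                                     (IH (suc i) j (trans (sym (ℕ.+-suc i j)) (ℕ.suc-injective e))))
                                   (binomial-pascal a b n i j)

  linear-^ᴾ-homogeneous : ∀ a b n i j → ¬ (i ℕ.+ j ≡ n) → (linear a b ^ᴾ n) i j ≡ + 0
  linear-^ᴾ-homogeneous a b zero    zero    zero    ne = ⊥-elim (ne refl)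
  linear-^ᴾ-homogeneous a b zero    zero    (suc j) ne = refl
  linear-^ᴾ-homogeneous a b zero    (suc i) j       ne = refl
  linear-^ᴾ-homogeneous a b (suc n) i       j       ne =
    trans (linear-⊗ a b (linear a b ^ᴾ n) i j) (step i j ne)
    where
    P = linear a b ^ᴾ n
    IH = linear-^ᴾ-homogeneous a b n
    both-zero : ∀ a b → a * + 0 + b * + 0 ≡ + 0
    both-zero = solve-∀
    step : ∀ i j → ¬ (i ℕ.+ j ≡ suc n) → a * shiftX P i j + b * shiftY P i j ≡ + 0
    step zero    zero    ne = both-zero a b
    step (suc i) zero    ne =
      trans (cong (λ c → a * c + b * + 0) (IH i 0 (ne ∘ cong suc))) (both-zero a b)
    step zero    (suc j) ne =
      trans (cong (λ c → a * + 0 + b * c) (IH 0 j (ne ∘ cong suc))) (both-zero a b)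
    step (suc i) (suc j) ne =
      trans (cong₂ (λ u v → a * u + b * v)
              (IH i (suc j) (ne ∘ cong suc))
              (IH (suc i) j (λ e → ne (trans (ℕ.+-suc (suc i) j) (cong suc e)))))
            (both-zero a b)

  X≐linear : X ≐ linear (+ 1) (+ 0)
  X≐linear zero          zero          = refl
  X≐linear zero          (suc zero)    = refl
  X≐linear zero          (suc (suc j)) = refl
  X≐linear (suc zero)    zero          = refl
  X≐linear (suc zero)    (suc j)       = refl
  X≐linear (suc (suc i)) j             = refl

  Y≐linear : Y ≐ linear (+ 0) (+ 1)
  Y≐linear zero          zero          = refl
  Y≐linear zero          (suc zero)    = refl
  Y≐linear zero          (suc (suc j)) = refl
  Y≐linear (suc zero)    zero          = refl
  Y≐linear (suc zero)    (suc j)       = refl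
  Y≐linear (suc (suc i)) j             = refl

  X-⊗ : ∀ g → X ⊗ g ≐ shiftX g
  X-⊗ g i j = begin
    (X ⊗ g) i j                                  ≡⟨ ⊗-cong {g = g} X≐linear (λ _ _ → refl) i j ⟩
    (linear (+ 1) (+ 0) ⊗ g) i j                 ≡⟨ linear-⊗ (+ 1) (+ 0) g i j ⟩
    + 1 * shiftX g i j + + 0 * shiftY g i j      ≡⟨ keep-first (shiftX g i j) (shiftY g i j) ⟩
    shiftX g i j                                 ∎
    where
    open ≡-Reasoning
    keep-first : ∀ u v → + 1 * u + + 0 * v ≡ u
    keep-first = solve-∀

  ⊗-Y : ∀ g → g ⊗ Y ≐ shiftY g
  ⊗-Y g i j = begin
    (g ⊗ Y) i j                                  ≡⟨ ⊗-comm g Y i j ⟩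
    (Y ⊗ g) i j                                  ≡⟨ ⊗-cong {g = g} Y≐linear (λ _ _ → refl) i j ⟩
    (linear (+ 0) (+ 1) ⊗ g) i j                 ≡⟨ linear-⊗ (+ 0) (+ 1) g i j ⟩
    + 0 * shiftX g i j + + 1 * shiftY g i j      ≡⟨ keep-second (shiftX g i j) (shiftY g i j) ⟩
    shiftY g i j                                 ∎
    where
    open ≡-Reasoning
    keep-second : ∀ u v → + 0 * u + + 1 * v ≡ v
    keep-second = solve-∀

  X^ᴾ-diagonal : ∀ n → (X ^ᴾ n) n 0 ≡ + 1
  X^ᴾ-diagonal zero    = refl
  X^ᴾ-diagonal (suc n) = trans (X-⊗ (X ^ᴾ n) (suc n) 0) (X^ᴾ-diagonal n)

  X^ᴾ-off-diagonal : ∀ n i j → ¬ (i ≡ n × j ≡ 0) → (X ^ᴾ n) i j ≡ + 0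
  X^ᴾ-off-diagonal zero    zero    zero    ne = ⊥-elim (ne (refl , refl))
  X^ᴾ-off-diagonal zero    zero    (suc j) ne = refl
  X^ᴾ-off-diagonal zero    (suc i) j       ne = refl
  X^ᴾ-off-diagonal (suc n) zero    j       ne = X-⊗ (X ^ᴾ n) 0 j
  X^ᴾ-off-diagonal (suc n) (suc i) j       ne =
    trans (X-⊗ (X ^ᴾ n) (suc i) j) (X^ᴾ-off-diagonal n i j (λ (i≡n , j≡0) → ne (cong suc i≡n , j≡0)))

module BinomialValuation where

  open import Data.Nat.Base
  open import Data.Nat.Properties
  open import Data.Nat.Divisibility
  open import Data.Nat.Primality using (Prime; euclidsLemma; prime⇒nonZero)
  open import Data.Nat.Combinatorics using (_C_; nC1≡n; nCk+nC[k+1]≡[n+1]C[k+1])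
  open import Data.Nat.Tactic.RingSolver using (solve-∀)
  open import Data.Sum.Base using (inj₁; inj₂)
  open import Data.Empty using (⊥-elim)
  open import Relation.Nullary using (¬_; yes; no)
  open import Relation.Binary.PropositionalEquality

  absorption : ∀ n k → suc k * (suc n C suc k) ≡ suc n * (n C k)
  absorption zero    zero    = refl
  absorption zero    (suc k) = *-zeroʳ (suc (suc k))
  absorption (suc n) zero    = trans (*-identityˡ (suc (suc n) C 1))
                                     (trans (nC1≡n (suc (suc n))) (sym (*-identityʳ (suc (suc n)))))
  absorption (suc n) (suc k) = begin
    suc (suc k) * (suc (suc n) C suc (suc k))
      ≡⟨ cong (suc (suc k) *_) (nCk+nC[k+1]≡[n+1]C[k+1] (suc n) (suc k)) ⟨
    suc (suc k) * (A + B)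
      ≡⟨ regroup (suc k) A B ⟩
    (suc k * A + A) + suc (suc k) * B
      ≡⟨ cong₂ (λ u v → (u + A) + v) (absorption n k) (absorption n (suc k)) ⟩
    (suc n * (n C k) + A) + suc n * (n C suc k)
      ≡⟨ cong (λ u → (suc n * (n C k) + u) + suc n * (n C suc k)) (nCk+nC[k+1]≡[n+1]C[k+1] n k) ⟨
    (suc n * (n C k) + (n C k + n C suc k)) + suc n * (n C suc k)
      ≡⟨ collect n (n C k) (n C suc k) ⟩
    suc (suc n) * (n C k + n C suc k)
      ≡⟨ cong (suc (suc n) *_) (nCk+nC[k+1]≡[n+1]C[k+1] n k) ⟩
    suc (suc n) * A
      ∎
    where
    open ≡-Reasoning
    A = suc n C suc k
    B = suc n C suc (suc k)
    regroup : ∀ k a b → suc k * (a + b) ≡ (k * a + a) + suc k * b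
    regroup = solve-∀
    collect : ∀ n x y → (suc n * x + (x + y)) + suc n * y ≡ suc (suc n) * (x + y)
    collect = solve-∀

  absorption₂ : ∀ n k → suc (suc k) * (suc k * (suc (suc n) C suc (suc k))) ≡ suc (suc n) * (suc n * (n C k))
  absorption₂ n k = begin
    suc (suc k) * (suc k * (suc (suc n) C suc (suc k)))
      ≡⟨ swap (suc (suc k)) (suc k) (suc (suc n) C suc (suc k)) ⟩
    suc k * (suc (suc k) * (suc (suc n) C suc (suc k)))
      ≡⟨ cong (suc k *_) (absorption (suc n) (suc k)) ⟩
    suc k * (suc (suc n) * (suc n C suc k))
      ≡⟨ swap (suc k) (suc (suc n)) (suc n C suc k) ⟩
    suc (suc n) * (suc k * (suc n C suc k))
      ≡⟨ cong (suc (suc n) *_) (absorption n k) ⟩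
    suc (suc n) * (suc n * (n C k))
      ∎
    where
    open ≡-Reasoning
    swap : ∀ x y z → x * (y * z) ≡ y * (x * z)
    swap = solve-∀

  ^-monoʳ-∣ : ∀ m {a b} → a ≤ b → m ^ a ∣ m ^ b
  ^-monoʳ-∣ m {a} {b} a≤b = subst (m ^ a ∣_) (trans (sym (^-distribˡ-+-* m a (b ∸ a))) (cong (m ^_) (m+[n∸m]≡n a≤b)))
                              (m∣m*n (m ^ (b ∸ a)))

  module OddPrime (p : ℕ) (p-prime : Prime p) (3≤p : 3 ≤ p) where

    private instance
      p≢0 : NonZero p
      p≢0 = prime⇒nonZero p-prime

    p∤1 : ¬ p ∣ 1
    p∤1 p∣1 = <⇒≢ (≤-trans (s≤s (s≤s z≤n)) 3≤p) (sym (∣1⇒≡1 p∣1))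

    p∤2 : ¬ p ∣ 2
    p∤2 p∣2 = <⇒≱ 3≤p (∣⇒≤ p∣2)

    p^s∣u*c⇒p^s∣c : ∀ s {u c} → ¬ p ∣ u → p ^ s ∣ u * c → p ^ s ∣ c
    p^s∣u*c⇒p^s∣c zero    {c = c} _   _ = 1∣ c
    p^s∣u*c⇒p^s∣c (suc s) {u} {c} p∤u p^s∣uc with euclidsLemma u c p-prime (∣-trans (m∣m*n (p ^ s)) p^s∣uc)
    ... | inj₁ p∣u              = ⊥-elim (p∤u p∣u)
    ... | inj₂ (divides c′ refl) =
      subst (p ^ suc s ∣_) (*-comm p c′)
        (*-monoʳ-∣ p (p^s∣u*c⇒p^s∣c s p∤u (*-cancelˡ-∣ p (subst (p * p ^ s ∣_) (shuffle u c′ p) p^s∣uc))))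
      where
      shuffle : ∀ u c p → u * (c * p) ≡ p * (u * c)
      shuffle = solve-∀

    p^a*c∣p^b*c : ∀ {a b} c → a ≤ b → p ^ a * c ∣ p ^ b * c
    p^a*c∣p^b*c c a≤b = *-monoˡ-∣ c (^-monoʳ-∣ p a≤b)

    p^s∣n*c⇒p^s∣p^[n∸2]*c : ∀ s n {c} → 2 ≤ n → p ^ s ∣ n * c → p ^ s ∣ p ^ (n ∸ 2) * c
    p^s∣n*c⇒p^s∣p^[n∸2]*c zero    n {c} _   _ = 1∣ (p ^ (n ∸ 2) * c)
    p^s∣n*c⇒p^s∣p^[n∸2]*c (suc s) n {c} 2≤n p^s∣nc with p ∣? n
    ... | no  p∤n              = ∣n⇒∣m*n (p ^ (n ∸ 2)) (p^s∣u*c⇒p^s∣c (suc s) p∤n p^s∣nc)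
    ... | yes (divides q refl) = from-quotient q 2≤n p^s∣qc
      where
      p^s∣qc : p ^ s ∣ q * c
      p^s∣qc = *-cancelˡ-∣ p (subst (p ^ suc s ∣_) (shuffle q p c) p^s∣nc)
        where
        shuffle : ∀ q p c → q * p * c ≡ p * (q * c)
        shuffle = solve-∀
      from-quotient : ∀ q → 2 ≤ q * p → p ^ s ∣ q * c → p ^ suc s ∣ p ^ (q * p ∸ 2) * c
      from-quotient 1 _ p^s∣c =
        ∣-trans (*-monoʳ-∣ p (subst (p ^ s ∣_) (*-identityˡ c) p^s∣c))
                (subst (λ x → x * c ∣ p ^ (1 * p ∸ 2) * c) (*-identityʳ p) (p^a*c∣p^b*c c 1≤p∸2))
        where
        1≤p∸2 : 1 ≤ 1 * p ∸ 2
        1≤p∸2 = m+n≤o⇒m≤o∸n 1 (subst (3 ≤_) (sym (+-identityʳ p)) 3≤p)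
      from-quotient (suc (suc q)) _ p^s∣qc =
        ∣-trans (*-monoʳ-∣ p (p^s∣n*c⇒p^s∣p^[n∸2]*c s (suc (suc q)) (s≤s (s≤s z≤n)) p^s∣qc))
                (subst (_∣ p ^ (suc (suc q) * p ∸ 2) * c) (*-assoc p (p ^ q) c) (p^a*c∣p^b*c c q+1≤[q+2]p∸2))
        where
        expand : ∀ q → suc q + 2 + (q + q + 3) ≡ suc (suc q) * 3
        expand = solve-∀
        q+1≤[q+2]p∸2 : suc q ≤ suc (suc q) * p ∸ 2
        q+1≤[q+2]p∸2 = m+n≤o⇒m≤o∸n (suc q)
          (≤-trans (subst (suc q + 2 ≤_) (expand q) (m≤m+n (suc q + 2) (q + q + 3))) (*-monoʳ-≤ (suc (suc q)) 3≤p))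

    p^s∣[1+n]*c⇒p^s∣p^n*c : ∀ s n {c} → p ^ s ∣ suc n * c → p ^ s ∣ p ^ n * c
    p^s∣[1+n]*c⇒p^s∣p^n*c s zero    p^s∣c  = p^s∣c
    p^s∣[1+n]*c⇒p^s∣p^n*c s (suc n) {c} p^s∣nc =
      ∣-trans (p^s∣n*c⇒p^s∣p^[n∸2]*c s (suc (suc n)) (s≤s (s≤s z≤n)) p^s∣nc) (p^a*c∣p^b*c c (n≤1+n n))

    n∣2*nC2 : ∀ n → n ∣ 2 * (n C 2)
    n∣2*nC2 zero    = ∣-refl
    n∣2*nC2 (suc n) = subst (suc n ∣_) (sym (absorption n 1)) (m∣m*n (n C 1))

    p∣pC2 : p ∣ p C 2
    p∣pC2 with euclidsLemma 2 (p C 2) p-prime (n∣2*nC2 p)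
    ... | inj₁ p∣2   = ⊥-elim (p∤2 p∣2)
    ... | inj₂ p∣pC2 = p∣pC2

    p^[2+t]∣p^[2+k]*[2+n]C[2+k] : ∀ t n k → p ^ t ∣ suc n → p ^ (2 + t) ∣ p ^ (2 + k) * ((2 + n) C (2 + k))
    p^[2+t]∣p^[2+k]*[2+n]C[2+k] t n k p^t∣n+1 = subst (p ^ (2 + t) ∣_) (reassoc p (p ^ k) coeff)
                                         (*-monoʳ-∣ p (*-monoʳ-∣ p p^t∣p^k*coeff))
      where
      coeff = (2 + n) C (2 + k)
      reassoc : ∀ p x y → p * (p * (x * y)) ≡ p * (p * x) * y
      reassoc = solve-∀
      p^t∣[k+2][k+1]coeff : p ^ t ∣ (2 + k) * ((1 + k) * coeff)
      p^t∣[k+2][k+1]coeff = subst (p ^ t ∣_) (sym (absorption₂ n k)) (∣n⇒∣m*n (2 + n) (∣m⇒∣m*n (n C k) p^t∣n+1))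
      p^t∣p^k*coeff : p ^ t ∣ p ^ k * coeff
      p^t∣p^k*coeff with p ∣? suc k
      ... | no p∤k+1 = p^s∣n*c⇒p^s∣p^[n∸2]*c t (2 + k) (s≤s (s≤s z≤n))
                         (p^s∣u*c⇒p^s∣c t p∤k+1 (subst (p ^ t ∣_) (swap (2 + k) (1 + k) coeff) p^t∣[k+2][k+1]coeff))
        where
        swap : ∀ x y z → x * (y * z) ≡ y * (x * z)
        swap = solve-∀
      ... | yes p∣k+1 = p^s∣[1+n]*c⇒p^s∣p^n*c t k (p^s∣u*c⇒p^s∣c t p∤k+2 p^t∣[k+2][k+1]coeff)
        where
        p∤k+2 : ¬ p ∣ 2 + k
        p∤k+2 p∣k+2 = p∤1 (∣m+n∣m⇒∣n (subst (p ∣_) (+-comm 1 (1 + k)) p∣k+2) p∣k+1)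

module PowerCongruences where

  open import Data.Nat.Base as ℕ using (ℕ; zero; suc)
  import Data.Nat.Properties as ℕ
  open import Data.Nat.Combinatorics using (_C_; nC1≡n; nCk+nC[k+1]≡[n+1]C[k+1])
  open import Data.Integer.Base using (ℤ; +_; _+_; _-_; _*_; -_; _^_)
  import Data.Integer.Properties as ℤ
  open import Data.Integer.Divisibility.Signed using (_∣_; divides)
  open import Data.Integer.Tactic.RingSolver using (solve-∀)
  open import Relation.Binary.PropositionalEquality
  open Congruence

  pos-^ : ∀ a n → + (a ℕ.^ n) ≡ (+ a) ^ n
  pos-^ a zero    = refl
  pos-^ a (suc n) = trans (ℤ.pos-* a (a ℕ.^ n)) (cong (+ a *_) (pos-^ a n))

  first-order-binomial : ∀ n b x → (b + x) ^ suc n ≡ b ^ suc n + + suc n * b ^ n * x [mod x * x ]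
  first-order-binomial zero    b x = ≡⇒≡-mod (linear b x)
    where
    linear : ∀ b x → (b + x) * + 1 ≡ b * + 1 + + 1 * + 1 * x
    linear = solve-∀
  first-order-binomial (suc n) b x = begin
    (b + x) * (b + x) ^ suc n                       ≈⟨ *-congˡ-mod (b + x) (first-order-binomial n b x) ⟩
    (b + x) * (b ^ suc n + + suc n * b ^ n * x)     ≈⟨ mod-∣ (divides (+ suc n * b ^ n) (drop-x² b x (b ^ n) (+ suc n))) ⟩
    b * b ^ suc n + + suc (suc n) * b ^ suc n * x   ∎
    where
    open ≡-mod-Reasoning (x * x)
    drop-x² : ∀ b x B c → (b + x) * (b * B + c * B * x) - (b * (b * B) + (+ 1 + c) * (b * B) * x) ≡ (c * B) * (x * x)
    drop-x² = solve-∀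

  [1+n]C2≡n+nC2 : ∀ n → suc n C 2 ≡ n ℕ.+ n C 2
  [1+n]C2≡n+nC2 n = trans (sym (nCk+nC[k+1]≡[n+1]C[k+1] n 1)) (cong (ℕ._+ n C 2) (nC1≡n n))

  second-order-binomial : ∀ n x → (+ 1 + x) ^ n ≡ + 1 + + n * x + + (n C 2) * (x * x) [mod x * x * x ]
  second-order-binomial zero    x = ≡⇒≡-mod (constant x)
    where
    constant : ∀ x → + 1 ≡ + 1 + + 0 * x + + 0 * (x * x)
    constant = solve-∀
  second-order-binomial (suc n) x = begin
    (+ 1 + x) * (+ 1 + x) ^ n                                    ≈⟨ *-congˡ-mod (+ 1 + x) (second-order-binomial n x) ⟩
    (+ 1 + x) * (+ 1 + + n * x + + (n C 2) * (x * x))            ≈⟨ mod-∣ (divides (+ (n C 2)) (drop-x³ x (+ n) (+ (n C 2)))) ⟩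
    + 1 + (+ 1 + + n) * x + (+ n + + (n C 2)) * (x * x)          ≡⟨ cong (λ c → + 1 + (+ 1 + + n) * x + c * (x * x)) pascal ⟩
    + 1 + + suc n * x + + (suc n C 2) * (x * x)                  ∎
    where
    open ≡-mod-Reasoning (x * x * x)
    drop-x³ : ∀ x n c → (+ 1 + x) * (+ 1 + n * x + c * (x * x)) - (+ 1 + (+ 1 + n) * x + (n + c) * (x * x)) ≡ c * (x * x * x)
    drop-x³ = solve-∀
    pascal : + n + + (n C 2) ≡ + (suc n C 2)
    pascal = trans (sym (ℤ.pos-+ n (n C 2))) (cong +_ (sym ([1+n]C2≡n+nC2 n)))

  near-one-^ : ∀ w {m x y} → x ≡ + 1 + y [mod m ] → m ∣ y * y → x ^ w ≡ + 1 + + w * y [mod m ]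
  near-one-^ zero    {y = y} _ _ = ≡⇒≡-mod (constant y)
    where
    constant : ∀ y → + 1 ≡ + 1 + + 0 * y
    constant = solve-∀
  near-one-^ (suc w) {m} {x} {y} x≡1+y (divides k y²≡km) = begin
    x * x ^ w                       ≈⟨ *-cong-mod x≡1+y (near-one-^ w x≡1+y (divides k y²≡km)) ⟩
    (+ 1 + y) * (+ 1 + + w * y)     ≈⟨ mod-∣ (divides (+ w * k) quadratic-term) ⟩
    + 1 + + suc w * y               ∎
    where
    open ≡-mod-Reasoning m
    drop-y² : ∀ y w → (+ 1 + y) * (+ 1 + w * y) - (+ 1 + (+ 1 + w) * y) ≡ w * (y * y)
    drop-y² = solve-∀
    quadratic-term : (+ 1 + y) * (+ 1 + + w * y) - (+ 1 + + suc w * y) ≡ + w * k * m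
    quadratic-term = trans (drop-y² y (+ w)) (trans (cong (+ w *_) y²≡km) (sym (ℤ.*-assoc (+ w) k m)))

  module Lifting (p₁ : ℕ) where

    p : ℕ
    p = suc p₁

    pℤ : ℤ
    pℤ = + p

    ^-p^suc : ∀ a k → a ^ (p ℕ.^ suc k) ≡ (a ^ (p ℕ.^ k)) ^ p
    ^-p^suc a k = trans (cong (a ^_) (ℕ.*-comm p (p ℕ.^ k))) (sym (ℤ.^-*-assoc a (p ℕ.^ k) p))

    ^p-lift : ∀ s {a b} → a ≡ b [mod pℤ ^ suc s ] → a ^ p ≡ b ^ p [mod pℤ ^ suc (suc s) ]
    ^p-lift s {a} {b} (mod-∣ (divides k a-b≡kpˢ⁺¹)) = begin
      a ^ p                                      ≡⟨ cong (_^ p) (b+[a-b] a b) ⟨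
      (b + (a - b)) ^ p                          ≈⟨ ≡-mod-∣-weaken pˢ⁺²∣[a-b]² (first-order-binomial p₁ b (a - b)) ⟩
      b ^ p + pℤ * b ^ p₁ * (a - b)              ≈⟨ mod-∣ (divides (b ^ p₁ * k) linear-term) ⟩
      b ^ p                                      ∎
      where
      open ≡-mod-Reasoning (pℤ ^ suc (suc s))
      b+[a-b] : ∀ a b → b + (a - b) ≡ a
      b+[a-b] = solve-∀
      square : ∀ k p u → (k * (p * u)) * (k * (p * u)) ≡ (k * k * u) * (p * (p * u))
      square = solve-∀
      pˢ⁺²∣[a-b]² : pℤ ^ suc (suc s) ∣ (a - b) * (a - b)
      pˢ⁺²∣[a-b]² = divides (k * k * pℤ ^ s) (trans (cong₂ _*_ a-b≡kpˢ⁺¹ a-b≡kpˢ⁺¹) (square k pℤ (pℤ ^ s)))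
      linear-term : b ^ p + pℤ * b ^ p₁ * (a - b) - b ^ p ≡ b ^ p₁ * k * pℤ ^ suc (suc s)
      linear-term = trans (rearrange (b ^ p) (b ^ p₁) (a - b) pℤ)
                          (trans (cong (λ x → pℤ * b ^ p₁ * x) a-b≡kpˢ⁺¹) (regroup (b ^ p₁) k pℤ (pℤ ^ s)))
        where
        rearrange : ∀ c B x p → c + p * B * x - c ≡ p * B * x
        rearrange = solve-∀
        regroup : ∀ B k p u → p * B * (k * (p * u)) ≡ B * k * (p * (p * u))
        regroup = solve-∀

    ≡-mod-p⇒≡-mod-p^1 : ∀ {a b} → a ≡ b [mod pℤ ] → a ≡ b [mod pℤ ^ 1 ]
    ≡-mod-p⇒≡-mod-p^1 = ≡-mod-∣-weaken (divides (+ 1) (p≡1*p¹ pℤ))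
      where
      p≡1*p¹ : ∀ p → p ≡ + 1 * (p * + 1)
      p≡1*p¹ = solve-∀

    ^p^k-lift : ∀ k {a b} → a ≡ b [mod pℤ ] → a ^ (p ℕ.^ k) ≡ b ^ (p ℕ.^ k) [mod pℤ ^ suc k ]
    ^p^k-lift zero    {a} {b} a≡b = subst₂ (λ x y → x ≡ y [mod pℤ ^ 1 ])
                                      (sym (ℤ.*-identityʳ a)) (sym (ℤ.*-identityʳ b))
                                      (≡-mod-p⇒≡-mod-p^1 a≡b)
    ^p^k-lift (suc k) {a} {b} a≡b = subst₂ (λ x y → x ≡ y [mod pℤ ^ suc (suc k) ])
                                      (sym (^-p^suc a k)) (sym (^-p^suc b k))
                                      (^p-lift k (^p^k-lift k a≡b))

    ^p^k-fixed : ∀ k {a m} → a ^ p ≡ a [mod m ] → a ^ (p ℕ.^ k) ≡ a [mod m ]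
    ^p^k-fixed zero    {a} _      = ≡⇒≡-mod (ℤ.*-identityʳ a)
    ^p^k-fixed (suc k) {a} aᵖ≡a = subst (λ x → x ≡ a [mod _ ]) (sym (^-p^suc a k))
                                     (≡-mod-trans (^-cong-mod p (^p^k-fixed k aᵖ≡a)) aᵖ≡a)

    -- p ∣ C(p,2), i.e. p odd, is what kills the quadratic term of (1 + p^(s+1) y)^p when s = 0.
    module _ (p∣pC2 : pℤ ∣ + (p C 2)) where

      near-one-^p : ∀ s y → (+ 1 + pℤ ^ suc s * y) ^ p ≡ + 1 + pℤ ^ suc (suc s) * y [mod pℤ ^ suc (suc (suc s)) ]
      near-one-^p s y = begin
        (+ 1 + x) ^ p                                       ≈⟨ ≡-mod-∣-weaken pˢ⁺³∣x³ (second-order-binomial p x) ⟩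
        + 1 + pℤ * x + + (p C 2) * (x * x)                  ≡⟨ cong (λ b → + 1 + pℤ * x + b * (x * x)) pC2≡cp ⟩
        + 1 + pℤ * x + c * pℤ * (x * x)                     ≈⟨ mod-∣ (divides (c * u * y * y) (quadratic-term c pℤ u y)) ⟩
        + 1 + pℤ ^ suc (suc s) * y                          ∎
        where
        open ≡-mod-Reasoning (pℤ ^ suc (suc (suc s)))
        open _∣_ p∣pC2 renaming (quotient to c; equality to pC2≡cp)
        u = pℤ ^ s
        x = pℤ ^ suc s * y
        cube : ∀ p u y → (p * u * y) * (p * u * y) * (p * u * y) ≡ (u * u * y * y * y) * (p * (p * (p * u)))
        cube = solve-∀
        pˢ⁺³∣x³ : pℤ ^ suc (suc (suc s)) ∣ x * x * x
        pˢ⁺³∣x³ = divides (u * u * y * y * y) (cube pℤ u y)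
        quadratic-term : ∀ c p u y → + 1 + p * (p * u * y) + c * p * ((p * u * y) * (p * u * y)) - (+ 1 + p * (p * u) * y)
                                      ≡ c * u * y * y * (p * (p * (p * u)))
        quadratic-term = solve-∀

      near-one-^p^s : ∀ s {a q} → a ≡ + 1 + q * pℤ → a ^ (p ℕ.^ s) ≡ + 1 + pℤ ^ suc s * q [mod pℤ ^ suc (suc s) ]
      near-one-^p^s zero    {a} {q} refl = ≡⇒≡-mod (exponent-one q pℤ)
        where
        exponent-one : ∀ q p → (+ 1 + q * p) * + 1 ≡ + 1 + p * + 1 * q
        exponent-one = solve-∀
      near-one-^p^s (suc s) {a} {q} a≡1+qp = begin
        a ^ (p ℕ.^ suc s)                  ≡⟨ ^-p^suc a s ⟩
        (a ^ (p ℕ.^ s)) ^ p                ≈⟨ ^p-lift (suc s) (near-one-^p^s s a≡1+qp) ⟩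
        (+ 1 + pℤ ^ suc s * q) ^ p         ≈⟨ near-one-^p s q ⟩
        + 1 + pℤ ^ suc (suc s) * q         ∎
        where open ≡-mod-Reasoning (pℤ ^ suc (suc (suc s)))

      module _ (t w : ℕ) {d q : ℤ} (dᵖ⁻¹≡1+qp : d ^ p₁ ≡ + 1 + q * pℤ) where

        unit-^-multiple : d ^ (p₁ ℕ.* (p ℕ.^ t ℕ.* w)) ≡ + 1 + + w * (pℤ ^ suc t * q) [mod pℤ ^ suc (suc t) ]
        unit-^-multiple = subst (λ x → x ≡ _ [mod _ ]) (exponent-assoc d)
                            (near-one-^ w (near-one-^p^s t dᵖ⁻¹≡1+qp) (divides (pℤ ^ t * q * q) (square pℤ (pℤ ^ t) q)))
          where
          exponent-assoc : ∀ d → ((d ^ p₁) ^ (p ℕ.^ t)) ^ w ≡ d ^ (p₁ ℕ.* (p ℕ.^ t ℕ.* w))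
          exponent-assoc d = trans (ℤ.^-*-assoc (d ^ p₁) (p ℕ.^ t) w) (ℤ.^-*-assoc d p₁ (p ℕ.^ t ℕ.* w))
          square : ∀ p u q → (p * u * q) * (p * u * q) ≡ (u * q * q) * (p * (p * u))
          square = solve-∀

        unit-^-multiple≡1 : d ^ (p₁ ℕ.* (p ℕ.^ t ℕ.* w)) ≡ + 1 [mod pℤ ^ suc t ]
        unit-^-multiple≡1 = ≡-mod-trans (≡-mod-∣-weaken (divides pℤ refl) unit-^-multiple)
                                        (mod-∣ (divides (+ w * q) (drop (pℤ ^ suc t) q (+ w))))
          where
          drop : ∀ P q w → + 1 + w * (P * q) - + 1 ≡ w * q * P
          drop = solve-∀

        unit-^-suc-multiple : d ^ suc (p₁ ℕ.* (p ℕ.^ t ℕ.* w))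
                                ≡ (+ 1 - + w * pℤ ^ t) * d + + w * pℤ ^ t * d ^ p [mod pℤ ^ suc (suc t) ]
        unit-^-suc-multiple = begin
          d * d ^ (p₁ ℕ.* (p ℕ.^ t ℕ.* w))                          ≈⟨ *-congˡ-mod d unit-^-multiple ⟩
          d * (+ 1 + + w * (pℤ * pℤ ^ t * q))                        ≡⟨ expand d (+ w) (pℤ ^ t) q pℤ ⟩
          (+ 1 - W) * d + W * (d * (+ 1 + q * pℤ))                    ≡⟨ cong (λ x → (+ 1 - W) * d + W * (d * x)) dᵖ⁻¹≡1+qp ⟨
          (+ 1 - W) * d + W * d ^ p                                   ∎
          where
          open ≡-mod-Reasoning (pℤ ^ suc (suc t))
          W = + w * pℤ ^ t
          expand : ∀ d w u q p → d * (+ 1 + w * (p * u * q)) ≡ (+ 1 - w * u) * d + w * u * (d * (+ 1 + q * p))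
          expand = solve-∀

module PowerSums where

  open import Data.Nat.Base as ℕ using (ℕ; zero; suc; _∸_)
  import Data.Nat.Properties as ℕ
  open import Data.Integer.Base using (ℤ; +_; _+_; _-_; _*_; -_; _^_)
  import Data.Integer.Properties as ℤ
  open import Data.Integer.Divisibility.Signed using (divides)
  open import Data.Integer.Tactic.RingSolver using (solve-∀)
  open import Relation.Binary.PropositionalEquality
  open import Defs using (sumTo)
  open Congruence
  open FiniteSums
  open PowerCongruences

  module OddModulus (h : ℕ) where

    p₁ : ℕ
    p₁ = h ℕ.+ h

    open Lifting p₁

    neg-^p : ∀ y → (- y) ^ p ≡ - y ^ p
    neg-^p y = begin
      - y * (- y) ^ (h ℕ.+ h)        ≡⟨ cong (λ e → - y * (- y) ^ e) h+h≡2h ⟩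
      - y * (- y) ^ (2 ℕ.* h)        ≡⟨ cong (- y *_) (ℤ.^-*-assoc (- y) 2 h) ⟨
      - y * ((- y) ^ 2) ^ h          ≡⟨ cong (λ z → - y * z ^ h) (neg-square y) ⟩
      - y * (y ^ 2) ^ h              ≡⟨ cong (- y *_) (ℤ.^-*-assoc y 2 h) ⟩
      - y * y ^ (2 ℕ.* h)            ≡⟨ cong (λ e → - y * y ^ e) h+h≡2h ⟨
      - y * y ^ (h ℕ.+ h)            ≡⟨ ℤ.neg-distribˡ-* y (y ^ (h ℕ.+ h)) ⟨
      - (y * y ^ (h ℕ.+ h))          ∎
      where
      open ≡-Reasoning
      h+h≡2h : h ℕ.+ h ≡ 2 ℕ.* h
      h+h≡2h = cong (h ℕ.+_) (sym (ℕ.+-identityʳ h))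
      neg-square : ∀ y → - y * (- y * + 1) ≡ y * (y * + 1)
      neg-square = solve-∀

    neg-^p^k : ∀ k y → (- y) ^ (p ℕ.^ k) ≡ - y ^ (p ℕ.^ k)
    neg-^p^k zero    y = trans (ℤ.*-identityʳ (- y)) (cong -_ (sym (ℤ.*-identityʳ y)))
    neg-^p^k (suc k) y = begin
      (- y) ^ (p ℕ.^ suc k)          ≡⟨ ^-p^suc (- y) k ⟩
      ((- y) ^ (p ℕ.^ k)) ^ p        ≡⟨ cong (_^ p) (neg-^p^k k y) ⟩
      (- y ^ (p ℕ.^ k)) ^ p          ≡⟨ neg-^p (y ^ (p ℕ.^ k)) ⟩
      - (y ^ (p ℕ.^ k)) ^ p          ≡⟨ cong -_ (^-p^suc y k) ⟨
      - y ^ (p ℕ.^ suc k)            ∎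
      where open ≡-Reasoning

    powerSum : ℕ → ℤ → ℤ
    powerSum k c = sumTo p (λ j → (+ j - c) ^ (p ℕ.^ k))

    powerSum-step : ∀ k c → powerSum k (c + + 1) ≡ powerSum k c [mod pℤ ^ suc k ]
    powerSum-step k c = begin
      powerSum k (c + + 1)                       ≡⟨ sumTo-suc-head p₁ (λ j → f (+ j - (c + + 1))) ⟩
      f (+ 0 - (c + + 1)) + sumTo p₁ (λ j → f (+ suc j - (c + + 1)))
        ≡⟨ cong (λ s → f (+ 0 - (c + + 1)) + s) (sumTo-cong p₁ (λ j _ → cong f (shift-index (+ j) c))) ⟩
      f (+ 0 - (c + + 1)) + sumTo p₁ (λ j → f (+ j - c))
        ≈⟨ +-cong-mod (≡-mod-sym (periodic (+ 0 - (c + + 1)))) ≡-mod-refl ⟩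
      f (+ 0 - (c + + 1) + pℤ) + sumTo p₁ (λ j → f (+ j - c))
        ≡⟨ cong (λ x → f x + sumTo p₁ (λ j → f (+ j - c))) (wrap-around (+ p₁) c) ⟩
      f (+ p₁ - c) + sumTo p₁ (λ j → f (+ j - c))
        ≡⟨ ℤ.+-comm (f (+ p₁ - c)) (sumTo p₁ (λ j → f (+ j - c))) ⟩
      powerSum k c                               ∎
      where
      open ≡-mod-Reasoning (pℤ ^ suc k)
      f : ℤ → ℤ
      f x = x ^ (p ℕ.^ k)
      periodic : ∀ x → f (x + pℤ) ≡ f x [mod pℤ ^ suc k ]
      periodic x = ^p^k-lift k (mod-∣ (divides (+ 1) (add-p x pℤ)))
        where
        add-p : ∀ x p → x + p - x ≡ + 1 * p
        add-p = solve-∀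
      shift-index : ∀ j c → + 1 + j - (c + + 1) ≡ j - c
      shift-index = solve-∀
      wrap-around : ∀ p₁ c → + 0 - (c + + 1) + (+ 1 + p₁) ≡ p₁ - c
      wrap-around = solve-∀

    powerSum-shift-to-0 : ∀ k c → powerSum k (+ c) ≡ powerSum k (+ 0) [mod pℤ ^ suc k ]
    powerSum-shift-to-0 k zero    = ≡-mod-refl
    powerSum-shift-to-0 k (suc c) = ≡-mod-trans one-step (powerSum-shift-to-0 k c)
      where
      one-step : powerSum k (+ suc c) ≡ powerSum k (+ c) [mod pℤ ^ suc k ]
      one-step = subst (λ x → powerSum k x ≡ powerSum k (+ c) [mod pℤ ^ suc k ]) (cong +_ (ℕ.+-comm c 1)) (powerSum-step k (+ c))

    powerSum-centre : ∀ k → powerSum k (+ h) ≡ + 0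
    powerSum-centre k = self-negating (powerSum k (+ h)) antisymmetric
      where
      f : ℤ → ℤ
      f x = x ^ (p ℕ.^ k)
      self-negating : ∀ x → x ≡ - x → x ≡ + 0
      self-negating x x≡-x = ℤ.*-cancelˡ-≡ (+ 2) x (+ 0) (trans (double x) (trans (cong (λ y → x + y) x≡-x) (cancel x)))
        where
        double : ∀ x → + 2 * x ≡ x + x
        double = solve-∀
        cancel : ∀ x → x + - x ≡ + 2 * + 0
        cancel = solve-∀
      reflect : ∀ j → j ℕ.≤ p₁ → + (p₁ ∸ j) - + h ≡ - (+ j - + h)
      reflect j j≤p₁ = begin
        + (p₁ ∸ j) - + h               ≡⟨ cong (_- + h) (trans (sym (ℤ.⊖-≥ j≤p₁)) (sym (ℤ.m-n≡m⊖n p₁ j))) ⟩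
        (+ h + + h) - + j - + h        ≡⟨ mirror (+ h) (+ j) ⟩
        - (+ j - + h)                  ∎
        where
        open ≡-Reasoning
        mirror : ∀ h j → (h + h) - j - h ≡ - (j - h)
        mirror = solve-∀
      antisymmetric : powerSum k (+ h) ≡ - powerSum k (+ h)
      antisymmetric = begin
        sumTo p (λ j → f (+ j - + h))               ≡⟨ sumTo-reverse p (λ j → f (+ j - + h)) ⟩
        sumTo p (λ j → f (+ (p₁ ∸ j) - + h))        ≡⟨ sumTo-cong p (λ j j<p → trans (cong f (reflect j (ℕ.≤-pred j<p)))
                                                                                      (neg-^p^k k (+ j - + h))) ⟩
        sumTo p (λ j → - f (+ j - + h))             ≡⟨ sumTo-neg p (λ j → f (+ j - + h)) ⟩
        - powerSum k (+ h)                          ∎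
        where open ≡-Reasoning

    powerSum≡0 : ∀ k c → powerSum k (+ c) ≡ + 0 [mod pℤ ^ suc k ]
    powerSum≡0 k c = ≡-mod-trans (powerSum-shift-to-0 k c)
                       (≡-mod-trans (≡-mod-sym (powerSum-shift-to-0 k h)) (≡⇒≡-mod (powerSum-centre k)))

module Teichmüller where

  open import Data.Nat.Base as ℕ using (ℕ; zero; suc; _<_)
  import Data.Nat.Properties as ℕ
  import Data.Nat.Divisibility as ℕ
  open import Data.Nat.Primality using (Prime; euclidsLemma)
  open import Data.Fin.Base using (Fin; toℕ; fromℕ<)
  import Data.Fin.Properties as Fin
  open import Data.Integer.Base using (ℤ; +_; _+_; _-_; _*_; -_; _^_; ∣_∣)
  import Data.Integer.Properties as ℤ
  open import Data.Integer.DivMod using (_%ℕ_; _/ℕ_; a≡a%ℕn+[a/ℕn]*n; n%ℕd<d)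
  open import Data.Integer.Divisibility.Signed using (_∣_; divides; ∣ᵤ⇒∣; ∣⇒∣ᵤ)
  open import Data.Integer.Tactic.RingSolver using (solve-∀)
  open import Data.Product.Base using (Σ; _,_; proj₁; proj₂)
  open import Data.Sum.Base using (inj₁; inj₂)
  open import Relation.Nullary.Negation using (¬_; contradiction)
  open import Relation.Binary.PropositionalEquality
  open import Defs using (IsTeichmüllerMod)
  open Congruence
  open FiniteSums
  open PowerCongruences
  open PowerSums

  prime-∣-* : ∀ {p a b} → Prime p → ¬ + p ∣ a → + p ∣ a * b → + p ∣ b
  prime-∣-* {p} {a} {b} p-prime p∤a p∣ab
    with euclidsLemma ∣ a ∣ ∣ b ∣ p-prime (subst (p ℕ.∣_) (ℤ.abs-* a b) (∣⇒∣ᵤ p∣ab))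
  ... | inj₁ p∣∣a∣ = contradiction (∣ᵤ⇒∣ p∣∣a∣) p∤a
  ... | inj₂ p∣∣b∣ = ∣ᵤ⇒∣ p∣∣b∣

  module Lifts (h : ℕ) (p-prime : Prime (suc (h ℕ.+ h))) (N : ℕ) (T : Fin (suc (h ℕ.+ h)) → ℤ)
                          (isTeichmüller : IsTeichmüllerMod (suc (h ℕ.+ h)) (suc N) T) where

    open OddModulus h
    open Lifting p₁

    T≡index : ∀ μ → T μ ≡ + toℕ μ [mod pℤ ]
    T≡index μ = mod-∣ (∣ᵤ⇒∣ (proj₁ (isTeichmüller μ)))

    T^p≡T : ∀ μ → T μ ^ p ≡ T μ [mod pℤ ^ suc N ]
    T^p≡T μ = mod-∣ (subst (_∣ T μ ^ p - T μ) (pos-^ p (suc N)) (∣ᵤ⇒∣ (proj₂ (isTeichmüller μ))))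

    -- Fermat's little theorem, read off from the lifts: a ≡ μ ≡ [μ] and [μ]^p ≡ [μ].
    fermat : ∀ a → a ^ p ≡ a [mod pℤ ]
    fermat a = begin
      a ^ p                 ≈⟨ ^-cong-mod p a≡ρ ⟩
      (+ ρ) ^ p             ≡⟨ cong (λ n → (+ n) ^ p) (Fin.toℕ-fromℕ< ρ<p) ⟨
      (+ toℕ μ) ^ p         ≈⟨ ^-cong-mod p (≡-mod-sym (T≡index μ)) ⟩
      T μ ^ p               ≈⟨ ≡-mod-∣-weaken (divides (pℤ ^ N) (ℤ.*-comm pℤ (pℤ ^ N))) (T^p≡T μ) ⟩
      T μ                   ≈⟨ T≡index μ ⟩
      + toℕ μ               ≡⟨ cong +_ (Fin.toℕ-fromℕ< ρ<p) ⟩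
      + ρ                   ≈⟨ ≡-mod-sym a≡ρ ⟩
      a                     ∎
      where
      open ≡-mod-Reasoning pℤ
      ρ = a %ℕ p
      ρ<p : ρ < p
      ρ<p = n%ℕd<d a p
      μ : Fin p
      μ = fromℕ< ρ<p
      a≡ρ : a ≡ + ρ [mod pℤ ]
      a≡ρ = mod-∣ (divides (a /ℕ p) (trans (cong (_- + ρ) (a≡a%ℕn+[a/ℕn]*n a p)) (cancel (+ ρ) (a /ℕ p) pℤ)))
        where
        cancel : ∀ r q p → r + q * p - r ≡ q * p
        cancel = solve-∀

    unit-power : ∀ d → ¬ pℤ ∣ d → Σ ℤ λ q → d ^ p₁ ≡ + 1 + q * pℤ
    unit-power d p∤d = quotient p∣dᵖ⁻¹-1 , trans (sym (add-back (d ^ p₁))) (cong (λ x → + 1 + x) (equality p∣dᵖ⁻¹-1))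
      where
      open _∣_
      factor : ∀ d D → d * D - d ≡ d * (D - + 1)
      factor = solve-∀
      add-back : ∀ D → + 1 + (D - + 1) ≡ D
      add-back = solve-∀
      p∣dᵖ⁻¹-1 : pℤ ∣ d ^ p₁ - + 1
      p∣dᵖ⁻¹-1 = prime-∣-* p-prime p∤d (subst (pℤ ∣_) (factor d (d ^ p₁)) (∣-difference (fermat d)))

    distinct-residues : ∀ {a b} → a < p → b < p → pℤ ∣ + a - + b → a ≡ b
    distinct-residues {a} {b} a<p b<p p∣a-b with ∣ + a - + b ∣ in ∣a-b∣≡
    ... | zero  = ℤ.+-injective (ℤ.i-j≡0⇒i≡j (+ a) (+ b) (ℤ.∣i∣≡0⇒i≡0 ∣a-b∣≡))
    ... | suc _ = contradiction (subst (p ℕ.∣_) ∣a-b∣≡ (∣⇒∣ᵤ p∣a-b)) (ℕ.>⇒∤ (subst (_< p) ∣a-b∣≡ ∣a-b∣<p))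
      where
      ∣a-b∣<p : ∣ + a - + b ∣ < p
      ∣a-b∣<p = subst (_< p) (cong ∣_∣ (sym (ℤ.m-n≡m⊖n a b))) (ℕ.≤-<-trans (ℤ.∣m⊝n∣≤m⊔n a b) (ℕ.⊔-pres-<m a<p b<p))

    T-difference-unit : ∀ {μ l} → μ ≢ l → ¬ pℤ ∣ T μ - T l
    T-difference-unit {μ} {l} μ≢l p∣Tμ-Tl = μ≢l (Fin.toℕ-injective
      (distinct-residues (Fin.toℕ<n μ) (Fin.toℕ<n l) (≡-mod-0⇒∣ μ-l≡0)))
      where
      μ-l≡0 : + toℕ μ - + toℕ l ≡ + 0 [mod pℤ ]
      μ-l≡0 = ≡-mod-trans (-‿cong-mod (≡-mod-sym (T≡index μ)) (≡-mod-sym (T≡index l))) (∣⇒≡-mod-0 p∣Tμ-Tl)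

    sum-T≡0 : sum T ≡ + 0 [mod pℤ ^ suc N ]
    sum-T≡0 = begin
      sum T                                          ≈⟨ sum-cong-mod {n = p} T≡index^p^N ⟩
      sum {p} (λ μ → (+ toℕ μ - + 0) ^ (p ℕ.^ N))      ≡⟨ sum-toℕ {p} (λ j → (+ j - + 0) ^ (p ℕ.^ N)) ⟩
      powerSum N (+ 0)                               ≈⟨ powerSum≡0 N 0 ⟩
      + 0                                            ∎
      where
      open ≡-mod-Reasoning (pℤ ^ suc N)
      T≡index^p^N : ∀ μ → T μ ≡ (+ toℕ μ - + 0) ^ (p ℕ.^ N) [mod pℤ ^ suc N ]
      T≡index^p^N μ = ≡-mod-trans (≡-mod-sym (^p^k-fixed N (T^p≡T μ)))
                        (^p^k-lift N (≡-mod-trans (T≡index μ) (≡⇒≡-mod (sym (ℤ.+-identityʳ (+ toℕ μ))))))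

    sum-[T-Tl]^p≡0 : ∀ l → sum (λ μ → (T μ - T l) ^ p) ≡ + 0 [mod pℤ ^ 2 ]
    sum-[T-Tl]^p≡0 l = begin
      sum (λ μ → (T μ - T l) ^ p)                    ≈⟨ sum-cong-mod {n = p} [T-Tl]^p≡[μ-l]^p ⟩
      sum {p} (λ μ → (+ toℕ μ - + toℕ l) ^ (p ℕ.^ 1))  ≡⟨ sum-toℕ {p} (λ j → (+ j - + toℕ l) ^ (p ℕ.^ 1)) ⟩
      powerSum 1 (+ toℕ l)                           ≈⟨ powerSum≡0 1 (toℕ l) ⟩
      + 0                                            ∎
      where
      open ≡-mod-Reasoning (pℤ ^ 2)
      [T-Tl]^p≡[μ-l]^p : ∀ μ → (T μ - T l) ^ p ≡ (+ toℕ μ - + toℕ l) ^ (p ℕ.^ 1) [mod pℤ ^ 2 ]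
      [T-Tl]^p≡[μ-l]^p μ = subst (λ e → (T μ - T l) ^ p ≡ (+ toℕ μ - + toℕ l) ^ e [mod pℤ ^ 2 ]) (sym (ℕ.*-identityʳ p))
                             (^p-lift 0 (≡-mod-p⇒≡-mod-p^1 (-‿cong-mod (T≡index μ) (T≡index l))))

module Comparison where

  open import Data.Nat.Base as ℕ using (ℕ; zero; suc)
  import Data.Nat.Properties as ℕ
  import Data.Nat.Divisibility as ℕ
  open import Data.Nat.Primality using (Prime)
  open import Data.Nat.Combinatorics using (_C_; nC1≡n)
  open import Data.Fin.Base using (Fin; punchIn)
  import Data.Fin.Properties as Fin
  open import Data.Integer.Base using (ℤ; +_; _+_; _-_; _*_; -_; _^_)
  import Data.Integer.Properties as ℤ
  open import Data.Integer.Divisibility.Signed using (_∣_; divides; ∣ᵤ⇒∣; ∣m⇒∣m*n)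
  open import Data.Integer.Tactic.RingSolver using (solve-∀)
  open import Data.Product.Base using (Σ; _,_; _×_)
  open import Relation.Nullary using (¬_; yes; no)
  open import Relation.Binary.PropositionalEquality
  open import Defs
  open Congruence
  open FiniteSums
  open BivariatePolynomials
  open BinomialValuation
  open PowerCongruences
  open PowerSums
  open Teichmüller

  module Coefficients (h r₀ t w : ℕ) (p-prime : Prime (suc (h ℕ.+ h))) (2<p : 2 ℕ.< suc (h ℕ.+ h))
                      (r-1≡p₁pᵗw : suc r₀ ≡ (h ℕ.+ h) ℕ.* (suc (h ℕ.+ h) ℕ.^ t ℕ.* w))
                      (T : Fin (suc (h ℕ.+ h)) → ℤ) (isTeichmüller : IsTeichmüllerMod (suc (h ℕ.+ h)) (suc (suc t)) T)
                      (l : Fin (suc (h ℕ.+ h))) where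

    open Lifts h p-prime (suc t) T isTeichmüller
    open OddModulus h
    open Lifting p₁

    r : ℕ
    r = suc (suc r₀)

    M : ℤ
    M = pℤ ^ suc (suc t)

    W : ℤ
    W = + w * pℤ ^ t

    d : Fin p → ℤ
    d μ = T μ - T l

    d-self : d l ≡ + 0
    d-self = ℤ.+-inverseʳ (T l)

    p∣pC2 : pℤ ∣ + (p C 2)
    p∣pC2 = ∣ᵤ⇒∣ (OddPrime.p∣pC2 p p-prime 2<p)

    +r≡1+p₁W : + r ≡ + 1 + + p₁ * W
    +r≡1+p₁W = cong (λ n → + 1 + n) (begin
      + suc r₀                             ≡⟨ cong +_ r-1≡p₁pᵗw ⟩
      + (p₁ ℕ.* (p ℕ.^ t ℕ.* w))           ≡⟨ ℤ.pos-* p₁ (p ℕ.^ t ℕ.* w) ⟩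
      + p₁ * + (p ℕ.^ t ℕ.* w)             ≡⟨ cong (+ p₁ *_) (ℤ.pos-* (p ℕ.^ t) w) ⟩
      + p₁ * (+ (p ℕ.^ t) * + w)           ≡⟨ cong (λ x → + p₁ * (x * + w)) (pos-^ p t) ⟩
      + p₁ * (pℤ ^ t * + w)                ≡⟨ cong (+ p₁ *_) (ℤ.*-comm (pℤ ^ t) (+ w)) ⟩
      + p₁ * W                             ∎)
      where open ≡-Reasoning

    d^r≡ : ∀ μ → d μ ^ r ≡ (+ 1 - W) * d μ + W * d μ ^ p [mod M ]
    d^r≡ μ with μ Fin.≟ l
    ... | yes refl = subst (λ x → x ^ r ≡ (+ 1 - W) * x + W * x ^ p [mod M ]) (sym d-self) (≡⇒≡-mod (vanish W))
      where
      vanish : ∀ W → + 0 ≡ (+ 1 - W) * + 0 + W * + 0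
      vanish = solve-∀
    ... | no  μ≢l = unit-case (unit-power (d μ) (T-difference-unit μ≢l))
      where
      unit-case : Σ ℤ (λ q → d μ ^ p₁ ≡ + 1 + q * pℤ) → d μ ^ r ≡ (+ 1 - W) * d μ + W * d μ ^ p [mod M ]
      unit-case (q , dᵖ⁻¹≡1+qp) = subst (λ e → d μ ^ suc e ≡ (+ 1 - W) * d μ + W * d μ ^ p [mod M ]) (sym r-1≡p₁pᵗw)
                                    (unit-^-suc-multiple p∣pC2 t w {q = q} dᵖ⁻¹≡1+qp)

    d^[r-1]≡1 : ∀ {μ} → μ ≢ l → d μ ^ suc r₀ ≡ + 1 [mod pℤ ^ suc t ]
    d^[r-1]≡1 {μ} μ≢l = unit-case (unit-power (d μ) (T-difference-unit μ≢l))
      where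
      unit-case : Σ ℤ (λ q → d μ ^ p₁ ≡ + 1 + q * pℤ) → d μ ^ suc r₀ ≡ + 1 [mod pℤ ^ suc t ]
      unit-case (q , dᵖ⁻¹≡1+qp) = subst (λ e → d μ ^ e ≡ + 1 [mod pℤ ^ suc t ]) (sym r-1≡p₁pᵗw)
                                    (unit-^-multiple≡1 p∣pC2 t w {q = q} dᵖ⁻¹≡1+qp)

    sum-d : sum d ≡ pℤ * - T l [mod M ]
    sum-d = begin
      sum d                             ≡⟨ ∑-distrib-+ T (λ _ → - T l) ⟩
      sum T + sum {p} (λ _ → - T l)     ≡⟨ cong (λ x → sum T + x) (sum-const p (- T l)) ⟩
      sum T + pℤ * - T l                ≈⟨ +-cong-mod sum-T≡0 ≡-mod-refl ⟩
      + 0 + pℤ * - T l                  ≡⟨ ℤ.+-identityˡ (pℤ * - T l) ⟩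
      pℤ * - T l                        ∎
      where open ≡-mod-Reasoning M

    W-sum-d^p≡0 : W * sum (λ μ → d μ ^ p) ≡ + 0 [mod M ]
    W-sum-d^p≡0 = ≡-mod-trans (≡-mod-∣-weaken M∣W*p² (≡-mod-scale W (sum-[T-Tl]^p≡0 l))) (≡⇒≡-mod (ℤ.*-zeroʳ W))
      where
      regroup : ∀ w u p → w * u * (p * (p * + 1)) ≡ w * (p * (p * u))
      regroup = solve-∀
      M∣W*p² : M ∣ W * pℤ ^ 2
      M∣W*p² = divides (+ w) (regroup (+ w) (pℤ ^ t) pℤ)

    sum-d^r : sum (λ μ → d μ ^ r) ≡ - (T l * + r * pℤ) [mod M ]
    sum-d^r = begin
      sum (λ μ → d μ ^ r)                             ≈⟨ sum-cong-mod d^r≡ ⟩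
      sum (λ μ → (+ 1 - W) * d μ + W * d μ ^ p)       ≡⟨ ∑-distrib-+ (λ μ → (+ 1 - W) * d μ) (λ μ → W * d μ ^ p) ⟩
      sum (λ μ → (+ 1 - W) * d μ) + sum (λ μ → W * d μ ^ p)
        ≡⟨ cong₂ _+_ (*-distribˡ-sum (+ 1 - W) d) (*-distribˡ-sum W (λ μ → d μ ^ p)) ⟨
      (+ 1 - W) * sum d + W * sum (λ μ → d μ ^ p)     ≈⟨ +-cong-mod (*-congˡ-mod (+ 1 - W) sum-d) W-sum-d^p≡0 ⟩
      (+ 1 - W) * (pℤ * - T l) + + 0                  ≈⟨ mod-∣ (divides (T l * + w) (collect (T l) (+ w) (pℤ ^ t) (+ p₁))) ⟩
      - (T l * (+ 1 + + p₁ * W) * pℤ)                 ≡⟨ cong (λ x → - (T l * x * pℤ)) +r≡1+p₁W ⟨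
      - (T l * + r * pℤ)                              ∎
      where
      open ≡-mod-Reasoning M
      collect : ∀ T w u P → (+ 1 - w * u) * ((+ 1 + P) * - T) + + 0 - - (T * (+ 1 + P * (w * u)) * (+ 1 + P))
                            ≡ T * w * ((+ 1 + P) * ((+ 1 + P) * u))
      collect = solve-∀

    sum-d^[r-1] : sum (λ μ → d μ ^ suc r₀) ≡ + p₁ [mod pℤ ^ suc t ]
    sum-d^[r-1] = begin
      sum (λ μ → d μ ^ suc r₀)                               ≡⟨ sum-remove {i = l} (λ μ → d μ ^ suc r₀) ⟩
      d l ^ suc r₀ + sum (λ j → d (punchIn l j) ^ suc r₀)    ≈⟨ +-cong-mod (≡⇒≡-mod (cong (_^ suc r₀) d-self)) units ⟩
      + 0 + sum {p₁} (λ _ → + 1)                             ≡⟨ cong (λ x → + 0 + x) (sum-const p₁ (+ 1)) ⟩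
      + 0 + + p₁ * + 1                                       ≡⟨ cong (λ x → + 0 + x) (ℤ.*-identityʳ (+ p₁)) ⟩
      + p₁                                                   ∎
      where
      open ≡-mod-Reasoning (pℤ ^ suc t)
      units : sum (λ j → d (punchIn l j) ^ suc r₀) ≡ sum {p₁} (λ _ → + 1) [mod pℤ ^ suc t ]
      units = sum-cong-mod (λ j → d^[r-1]≡1 (Fin.punchInᵢ≢i l j))

    p^[t+2]∣binomial-term : ∀ μ i k → M ∣ + (r C suc (suc k)) * (d μ ^ i * pℤ ^ suc (suc k))
    p^[t+2]∣binomial-term μ i k =
      subst (M ∣_) (rearrange (+ (r C suc (suc k))) (d μ ^ i) (pℤ ^ suc (suc k))) (∣m⇒∣m*n (d μ ^ i) p^[t+2]∣p^[k+2]C)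
      where
      rearrange : ∀ c x P → P * c * x ≡ c * (x * P)
      rearrange = solve-∀
      pᵗ∣r-1 : p ℕ.^ t ℕ.∣ suc r₀
      pᵗ∣r-1 = subst (p ℕ.^ t ℕ.∣_) (sym r-1≡p₁pᵗw) (ℕ.∣n⇒∣m*n p₁ (ℕ.m∣m*n w))
      cast : + (p ℕ.^ suc (suc k) ℕ.* (r C suc (suc k))) ≡ pℤ ^ suc (suc k) * + (r C suc (suc k))
      cast = trans (ℤ.pos-* (p ℕ.^ suc (suc k)) (r C suc (suc k))) (cong (_* + (r C suc (suc k))) (pos-^ p (suc (suc k))))
      p^[t+2]∣p^[k+2]C : M ∣ pℤ ^ suc (suc k) * + (r C suc (suc k))
      p^[t+2]∣p^[k+2]C = subst₂ _∣_ (pos-^ p (suc (suc t))) cast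
                           (∣ᵤ⇒∣ (OddPrime.p^[2+t]∣p^[2+k]*[2+n]C[2+k] p p-prime 2<p t r₀ k pᵗ∣r-1))

    B : Fin p → Poly2
    B μ = ((T μ · X) ⊖ (T l · X)) ⊕ (pℤ · Y)

    B≐linear : ∀ μ → B μ ≐ linear (d μ) pℤ
    B≐linear μ = coefficients
      where
      constant : ∀ a b c → a * + 0 - b * + 0 + c * + 0 ≡ + 0
      constant = solve-∀
      x-coefficient : ∀ a b c → a * + 1 - b * + 1 + c * + 0 ≡ a - b
      x-coefficient = solve-∀
      y-coefficient : ∀ a b c → a * + 0 - b * + 0 + c * + 1 ≡ c
      y-coefficient = solve-∀
      coefficients : B μ ≐ linear (d μ) pℤ
      coefficients zero          zero          = constant (T μ) (T l) pℤ
      coefficients zero          (suc zero)    = y-coefficient (T μ) (T l) pℤ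
      coefficients zero          (suc (suc j)) = constant (T μ) (T l) pℤ
      coefficients (suc zero)    zero          = x-coefficient (T μ) (T l) pℤ
      coefficients (suc zero)    (suc j)       = constant (T μ) (T l) pℤ
      coefficients (suc (suc i)) j             = constant (T μ) (T l) pℤ

    c₀ K : ℤ
    c₀ = - (T l * + r * pℤ)
    K  = + r * pℤ * + p₁

    LHS RHS : Poly2
    LHS = sumFin (λ μ → B μ ^ᴾ r)
    RHS = (c₀ · (X ^ᴾ r)) ⊕ (K · ((X ^ᴾ suc r₀) ⊗ Y))

    LHS-coefficient : ∀ i j → LHS i j ≡ sum (λ μ → (linear (d μ) pℤ ^ᴾ r) i j)
    LHS-coefficient i j = trans (sumFin-coefficient (λ μ → B μ ^ᴾ r) i j)
                                (sum-cong-≗ (λ μ → ^ᴾ-cong r (B≐linear μ) i j))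

    LHS-off-degree : ∀ i j → ¬ (i ℕ.+ j ≡ r) → LHS i j ≡ + 0
    LHS-off-degree i j off = trans (LHS-coefficient i j)
      (trans (sum-cong-≗ (λ μ → linear-^ᴾ-homogeneous (d μ) pℤ r i j off)) (sum-replicate-zero p))

    RHS-coefficient : ∀ i j → RHS i j ≡ c₀ * (X ^ᴾ r) i j + K * shiftY (X ^ᴾ suc r₀) i j
    RHS-coefficient i j = cong (λ x → c₀ * (X ^ᴾ r) i j + K * x) (⊗-Y (X ^ᴾ suc r₀) i j)

    RHS-vanishes : ∀ i j → ¬ (i ≡ r × j ≡ 0) → ¬ (i ≡ suc r₀ × j ≡ 1) → RHS i j ≡ + 0
    RHS-vanishes i j not-xʳ not-xʳ⁻¹y = trans (RHS-coefficient i j)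
      (trans (cong₂ (λ a b → c₀ * a + K * b) (X^ᴾ-off-diagonal r i j not-xʳ) (shifted j not-xʳ⁻¹y)) (both-zero c₀ K))
      where
      both-zero : ∀ a b → a * + 0 + b * + 0 ≡ + 0
      both-zero = solve-∀
      shifted : ∀ j → ¬ (i ≡ suc r₀ × j ≡ 1) → shiftY (X ^ᴾ suc r₀) i j ≡ + 0
      shifted zero    _   = refl
      shifted (suc j) not = X^ᴾ-off-diagonal (suc r₀) i j (λ (i≡ , j≡0) → not (i≡ , cong suc j≡0))

    coefficient-xʳ : LHS r 0 ≡ RHS r 0 [mod M ]
    coefficient-xʳ = begin
      LHS r 0                                    ≡⟨ LHS-coefficient r 0 ⟩
      sum (λ μ → (linear (d μ) pℤ ^ᴾ r) r 0)     ≡⟨ sum-cong-≗ x^r-term ⟩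
      sum (λ μ → d μ ^ r)                        ≈⟨ sum-d^r ⟩
      c₀                                         ≡⟨ RHS-xʳ ⟨
      RHS r 0                                    ∎
      where
      open ≡-mod-Reasoning M
      unit-factors : ∀ x → + 1 * (x * + 1) ≡ x
      unit-factors = solve-∀
      x^r-term : ∀ μ → (linear (d μ) pℤ ^ᴾ r) r 0 ≡ d μ ^ r
      x^r-term μ = trans (linear-^ᴾ-binomial (d μ) pℤ r r 0 (ℕ.+-identityʳ r)) (unit-factors (d μ ^ r))
      constant-term : ∀ c K → c * + 1 + K * + 0 ≡ c
      constant-term = solve-∀
      RHS-xʳ : RHS r 0 ≡ c₀
      RHS-xʳ = trans (RHS-coefficient r 0) (trans (cong (λ x → c₀ * x + K * + 0) (X^ᴾ-diagonal r)) (constant-term c₀ K))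

    coefficient-xʳ⁻¹y : LHS (suc r₀) 1 ≡ RHS (suc r₀) 1 [mod M ]
    coefficient-xʳ⁻¹y = begin
      LHS (suc r₀) 1                                   ≡⟨ LHS-coefficient (suc r₀) 1 ⟩
      sum (λ μ → (linear (d μ) pℤ ^ᴾ r) (suc r₀) 1)    ≡⟨ sum-cong-≗ x^[r-1]y-term ⟩
      sum (λ μ → + r * pℤ * d μ ^ suc r₀)              ≡⟨ *-distribˡ-sum (+ r * pℤ) (λ μ → d μ ^ suc r₀) ⟨
      + r * pℤ * sum (λ μ → d μ ^ suc r₀)              ≈⟨ ≡-mod-∣-weaken M∣rp·pᵗ⁺¹ (≡-mod-scale (+ r * pℤ) sum-d^[r-1]) ⟩
      K                                                ≡⟨ RHS-xʳ⁻¹y ⟨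
      RHS (suc r₀) 1                                   ∎
      where
      open ≡-mod-Reasoning M
      linear-factor : ∀ r p x → r * (x * (p * + 1)) ≡ r * p * x
      linear-factor = solve-∀
      x^[r-1]y-term : ∀ μ → (linear (d μ) pℤ ^ᴾ r) (suc r₀) 1 ≡ + r * pℤ * d μ ^ suc r₀
      x^[r-1]y-term μ = trans (linear-^ᴾ-binomial (d μ) pℤ r (suc r₀) 1 (ℕ.+-comm (suc r₀) 1))
                              (trans (cong (λ c → + c * (d μ ^ suc r₀ * (pℤ * + 1))) (nC1≡n r))
                                     (linear-factor (+ r) pℤ (d μ ^ suc r₀)))
      regroup : ∀ r p u → r * p * (p * u) ≡ r * (p * (p * u))
      regroup = solve-∀
      M∣rp·pᵗ⁺¹ : M ∣ + r * pℤ * pℤ ^ suc t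
      M∣rp·pᵗ⁺¹ = divides (+ r) (regroup (+ r) pℤ (pℤ ^ t))
      y-term : ∀ c K → c * + 0 + K * + 1 ≡ K
      y-term = solve-∀
      RHS-xʳ⁻¹y : RHS (suc r₀) 1 ≡ K
      RHS-xʳ⁻¹y = trans (RHS-coefficient (suc r₀) 1)
        (trans (cong₂ (λ a b → c₀ * a + K * b) (X^ᴾ-off-diagonal r (suc r₀) 1 (λ { (_ , ()) })) (X^ᴾ-diagonal (suc r₀)))
               (y-term c₀ K))

    higher-y-degree : ∀ i k → i ℕ.+ suc (suc k) ≡ r → LHS i (suc (suc k)) ≡ + 0 [mod M ]
    higher-y-degree i k on = begin
      LHS i (suc (suc k))                                           ≡⟨ LHS-coefficient i (suc (suc k)) ⟩
      sum (λ μ → (linear (d μ) pℤ ^ᴾ r) i (suc (suc k)))            ≡⟨ sum-cong-≗ binomial-term ⟩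
      sum (λ μ → + (r C suc (suc k)) * (d μ ^ i * pℤ ^ suc (suc k))) ≈⟨ sum-cong-mod (λ μ → ∣⇒≡-mod-0 (p^[t+2]∣binomial-term μ i k)) ⟩
      sum {p} (λ _ → + 0)                                           ≡⟨ sum-replicate-zero p ⟩
      + 0                                                           ∎
      where
      open ≡-mod-Reasoning M
      binomial-term : ∀ μ → (linear (d μ) pℤ ^ᴾ r) i (suc (suc k)) ≡ + (r C suc (suc k)) * (d μ ^ i * pℤ ^ suc (suc k))
      binomial-term μ = linear-^ᴾ-binomial (d μ) pℤ r i (suc (suc k)) on

    coefficient : ∀ i j → LHS i j ≡ RHS i j [mod M ]
    coefficient i j with i ℕ.+ j ℕ.≟ r
    ... | no off = ≡⇒≡-mod (trans (LHS-off-degree i j off) (sym (RHS-vanishes i j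
                     (λ (i≡r , j≡0) → off (trans (cong₂ ℕ._+_ i≡r j≡0) (ℕ.+-identityʳ r)))
                     (λ (i≡r-1 , j≡1) → off (trans (cong₂ ℕ._+_ i≡r-1 j≡1) (ℕ.+-comm (suc r₀) 1))))))
    coefficient i zero          | yes on =
      subst (λ i → LHS i 0 ≡ RHS i 0 [mod M ]) (sym (trans (sym (ℕ.+-identityʳ i)) on)) coefficient-xʳ
    coefficient i (suc zero)    | yes on =
      subst (λ i → LHS i 1 ≡ RHS i 1 [mod M ]) (sym (ℕ.suc-injective (trans (ℕ.+-comm 1 i) on))) coefficient-xʳ⁻¹y
    coefficient i (suc (suc k)) | yes on =
      ≡-mod-trans (higher-y-degree i k on) (≡⇒≡-mod (sym (RHS-vanishes i (suc (suc k)) (λ { (_ , ()) }) (λ { (_ , ()) }))))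

module Arithmetic where

  open import Data.Nat.Base
  open import Data.Nat.Properties
  open import Data.Nat.Divisibility
  open import Data.Nat.DivMod using (_%_; _/_; m≡m%n+[m/n]*n; m%n<n)
  open import Data.Nat.Primality using (Prime; prime⇒irreducible)
  open import Data.Nat.Coprimality using (Coprime; coprime-divisor)
  open import Data.Nat.Tactic.RingSolver using (solve-∀)
  open import Data.Product.Base using (Σ; _,_)
  open import Data.Sum.Base using (inj₁; inj₂)
  open import Relation.Nullary.Negation using (contradiction)
  open import Relation.Binary.PropositionalEquality

  odd-prime : ∀ {p} → Prime p → 2 < p → Σ ℕ λ h → p ≡ suc (h + h)
  odd-prime {p} p-prime 2<p with p % 2 | m≡m%n+[m/n]*n p 2 | m%n<n p 2
  ... | 0 | p≡[p/2]*2 | _ with prime⇒irreducible p-prime (divides (p / 2) p≡[p/2]*2)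
  ...   | inj₁ ()
  ...   | inj₂ refl = contradiction 2<p (<-irrefl refl)
  odd-prime {p} p-prime 2<p | 1 | p≡1+[p/2]*2 | _ = p / 2 , trans p≡1+[p/2]*2 (double (p / 2))
    where
    double : ∀ h → 1 + h * 2 ≡ suc (h + h)
    double = solve-∀
  odd-prime {p} p-prime 2<p | suc (suc _) | _ | s≤s (s≤s ())

  coprime-suc : ∀ q → Coprime q (suc q)
  coprime-suc q {d} (d∣q , d∣q+1) = ∣1⇒≡1 (∣m+n∣m⇒∣n (subst (d ∣_) (+-comm 1 q) d∣q+1) d∣q)

  ∣*[1+q]^t⇒∣ : ∀ q t {a} → q ∣ a * suc q ^ t → q ∣ a
  ∣*[1+q]^t⇒∣ q zero    {a} q∣a*1   = subst (q ∣_) (*-identityʳ a) q∣a*1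
  ∣*[1+q]^t⇒∣ q (suc t) {a} q∣a*qᵗ⁺¹ =
    ∣*[1+q]^t⇒∣ q t (coprime-divisor (coprime-suc q) (subst (q ∣_) (swap a (suc q) (suc q ^ t)) q∣a*qᵗ⁺¹))
    where
    swap : ∀ a s u → a * (s * u) ≡ s * (a * u)
    swap = solve-∀

  coprime-factors-quotient : ∀ q t {n} → q ∣ n → suc q ^ t ∣ n → Σ ℕ λ w → n ≡ q * (suc q ^ t * w)
  coprime-factors-quotient q t q∣n (divides a refl) with ∣*[1+q]^t⇒∣ q t {a} q∣n
  ... | divides w refl = w , regroup w q (suc q ^ t)
    where
    regroup : ∀ w q u → w * q * u ≡ q * (u * w)
    regroup = solve-∀

open import Defs
open import Data.Nat using (ℕ; suc; _<_; _∸_; _^_; _+_)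
open import Data.Nat.Divisibility using (_∣_)
open import Data.Nat.Primality using (Prime)
open import Data.Fin using (Fin)
open import Data.Integer as ℤ using (ℤ; +_; -_)
open import Relation.Nullary using (¬_)
open import Data.Nat.Base using (s≤s)
import Data.Nat.Properties as ℕ
open import Data.Product.Base using (_,_)
open import Data.Integer.Divisibility.Signed as ℤ∣ using (∣⇒∣ᵤ)
open import Relation.Binary.PropositionalEquality using (_≡_; refl; sym; subst; cong; trans)
open Congruence using (∣-difference)
open PowerCongruences using (pos-^)
open Comparison using (module Coefficients)

open Arithmetic

corollary2p6 : (p r t : ℕ) → Prime p → 2 < p → 1 < r → (p ∸ 1) ∣ (r ∸ 1)
  → p ^ t ∣ (r ∸ 1) → ¬ (p ^ suc t ∣ (r ∸ 1))
  → (T : Fin p → ℤ) → IsTeichmüllerMod p (t + 2) T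
  → (l : Fin p)
  → sumFin (λ μ → (((T μ · X) ⊖ (T l · X)) ⊕ ((+ p) · Y)) ^ᴾ r)
      ≡ (((ℤ.- (T l ℤ.* + r ℤ.* + p)) · (X ^ᴾ r)) ⊕ ((+ r ℤ.* + p ℤ.* + (p ∸ 1)) · ((X ^ᴾ (r ∸ 1)) ⊗ Y)))
      [modᴾ p ^ (t + 2) ]
corollary2p6 p (suc (suc r₀)) t p-prime 2<p (s≤s (s≤s _)) p-1∣r-1 pᵗ∣r-1 _ T isTeichmüller l with odd-prime p-prime 2<p
... | h , refl with coprime-factors-quotient (h + h) t p-1∣r-1 pᵗ∣r-1
...   | w , r-1≡[p-1]pᵗw = λ i j → ∣⇒∣ᵤ (subst (λ m → m ℤ∣.∣ LHS i j ℤ.- RHS i j) M≡pᵗ⁺² (∣-difference (coefficient i j)))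
  where
  open Coefficients h r₀ t w p-prime 2<p r-1≡[p-1]pᵗw T (subst (λ N → IsTeichmüllerMod p N T) (ℕ.+-comm t 2) isTeichmüller) l
  M≡pᵗ⁺² : M ≡ + (p ^ (t + 2))
  M≡pᵗ⁺² = trans (cong (ℤ._^_ (+ p)) (ℕ.+-comm 2 t)) (sym (pos-^ p (t + 2)))
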